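{- Let $p$ be a prime and $d,n\ge1$. Let $H$ be the additive cellular automaton over the alphabet $\mathbb{Z}_p^n$ determined by a polynomial $h=\sum_{i=0}^k\mathbf{A}_iX^{\vec u_i}\in\mathbb{Z}_p^{n\times n}[x_1^{\pm1},\dots,x_d^{\pm1}]$ whose coefficients $\mathbf{A}_i$ commute with each other. Assume there exist $M\in\mathbb{Z}_p\setminus\{0\}$ and matrices $\mathbf{C}_0,\dots,\mathbf{C}_k\in\mathbb{Z}_p^{n\times n}$ that commute with each other and with every $\mathbf{A}_i$, such that $\mathbf{C}_0\mathbf{A}_0+\dots+\mathbf{C}_k\mathbf{A}_k=M\cdot\mathbf{I}$ in $\mathbb{Z}_p^{n\times n}$. Then $H$ is surjective.
   Context: Configurations are elements $c\in(\mathbb{Z}_p^n)^{\mathbb{Z}^d}$, viewed as power series $\sum_{\vec u}c_{\vec u}X^{\vec u}$ with $X^{\vec u}=x_1^{u_1}\cdots x_d^{u_d}$. The additive cellular automaton determined by $h$ is the map $H:(\mathbb{Z}_p^n)^{\mathbb{Z}^d}\to(\mathbb{Z}_p^n)^{\mathbb{Z}^d}$ given by $H(c)=hc$, where $(hc)_{\vec u}=\sum_{i=0}^k\mathbf{A}_ic_{\vec u-\vec u_i}$ (column vectors, arithmetic mod $p$). $\mathbf{I}$ is the $n\times n$ identity matrix. -}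

module Defs where

open import Data.Nat as ℕ using (ℕ; zero; suc; NonZero)
open import Data.Nat.DivMod using (_mod_)
open import Data.Fin using (Fin; toℕ)
open import Data.Integer as ℤ using (ℤ)
open import Data.Vec using (Vec; zipWith)
open import Relation.Binary.PropositionalEquality using (_≡_)
import Relation.Nullary
import Data.Product

Zp : ℕ → Set
Zp p = Fin p

module _ {p : ℕ} .{{_ : NonZero p}} where

  infixl 6 _+ₚ_
  infixl 7 _*ₚ_

  _+ₚ_ : Zp p → Zp p → Zp p
  a +ₚ b = (toℕ a ℕ.+ toℕ b) mod p

  _*ₚ_ : Zp p → Zp p → Zp p
  a *ₚ b = (toℕ a ℕ.* toℕ b) mod p

  0ₚ : Zp p
  0ₚ = 0 mod p

  1ₚ : Zp p
  1ₚ = 1 mod p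

  Σₚ : (m : ℕ) → (Fin m → Zp p) → Zp p
  Σₚ zero    f = 0ₚ
  Σₚ (suc m) f = f Data.Fin.zero +ₚ Σₚ m (λ i → f (Data.Fin.suc i))

ZVec : ℕ → ℕ → Set
ZVec p n = Fin n → Zp p

Mat : ℕ → ℕ → Set
Mat p n = Fin n → Fin n → Zp p

module _ {p : ℕ} .{{_ : NonZero p}} {n : ℕ} where

  _⊗_ : Mat p n → Mat p n → Mat p n
  (A ⊗ B) r s = Σₚ n (λ t → A r t *ₚ B t s)

  _⊕_ : Mat p n → Mat p n → Mat p n
  (A ⊕ B) r s = A r s +ₚ B r s

  _·_ : Mat p n → ZVec p n → ZVec p n
  (A · v) r = Σₚ n (λ t → A r t *ₚ v t)

  _⊞_ : ZVec p n → ZVec p n → ZVec p n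
  (v ⊞ w) r = v r +ₚ w r

  zeroV : ZVec p n
  zeroV _ = 0ₚ

  scalarI : Zp p → Mat p n
  scalarI M r s with r Data.Fin.≟ s
  ... | Relation.Nullary.yes _ = M
  ... | Relation.Nullary.no  _ = 0ₚ

  _≈M_ : Mat p n → Mat p n → Set
  A ≈M B = ∀ r s → A r s ≡ B r s

  Commute : Mat p n → Mat p n → Set
  Commute A B = (A ⊗ B) ≈M (B ⊗ A)

  ΣM : (m : ℕ) → (Fin m → Mat p n) → Mat p n
  ΣM zero    F = λ _ _ → 0ₚ
  ΣM (suc m) F = F Data.Fin.zero ⊕ ΣM m (λ i → F (Data.Fin.suc i))

  ΣV : (m : ℕ) → (Fin m → ZVec p n) → ZVec p n
  ΣV zero    F = zeroV
  ΣV (suc m) F = F Data.Fin.zero ⊞ ΣV m (λ i → F (Data.Fin.suc i))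

Point : ℕ → Set
Point d = Vec ℤ d

_-ᵖ_ : ∀ {d} → Point d → Point d → Point d
_-ᵖ_ = zipWith ℤ._-_

Config : ℕ → ℕ → ℕ → Set
Config p n d = Point d → ZVec p n

-- The additive CA determined by h = Σ_{i=0}^k A_i X^{u_i}:
-- (h c)_u = Σ_i A_i c_{u - u_i}
additiveCA : ∀ {p n d} .{{_ : NonZero p}} (k : ℕ)
  → (A : Fin (suc k) → Mat p n) → (u : Fin (suc k) → Point d)
  → Config p n d → Config p n d
additiveCA k A u c v = ΣV (suc k) (λ i → A i · c (v -ᵖ u i))

Surjective : ∀ {p n d} → (Config p n d → Config p n d) → Set
Surjective {p} {n} {d} H =
  ∀ (e : Config p n d) → Data.Product.∃ λ (c : Config p n d) → ∀ v j → H c v j ≡ e v j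

{-# OPTIONS --safe #-}
-- The Aᵢ, the Cᵢ and the scalar matrices lie in the bicommutant of {Aᵢ, Cᵢ}, a commutative subring of the
-- matrix ring that is finite, so every element a has an idempotent power E = a ^ t. Dividing the hypothesis
-- by M puts 1 into the ideal generated by the coefficients of h. For an idempotent P of that ideal, h c = P e
-- is solved by induction on the terms of h: the idempotent power E of a coefficient a splits P into P E, on
-- which a is invertible, and P (1 - E), on which a is nilpotent; there the term a X^u can be dropped
-- (P (1 - E) still lies in the ideal of the other coefficients, by a geometric series) and then restored by a
-- finite correction. Once every coefficient is invertible on P, a solution is built layer by layer along the
-- first coordinate, upwards from the lowest and downwards from the highest slice of h, each layer being a
-- problem of the same kind in one dimension less; in dimension 0 a single term remains and is inverted.
module Submission where

open import Defs
open import Algebra.Bundles using (Ring; RawRing; CommutativeRing; CommutativeMonoid)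
open import Algebra.Structures using (IsCommutativeRing; IsAbelianGroup)
import Algebra.Consequences.Propositional as Consequences
import Algebra.Construct.Pointwise as Pointwise
open import Algebra.Module.Bundles using (LeftModule)
open import Algebra.Morphism.Structures using (IsRingMonomorphism)
import Algebra.Morphism.RingMonomorphism as RingMonomorphism
open import Data.Empty using (⊥-elim)
open import Data.Fin as Fin using (Fin; toℕ; punchIn; funToFin; finToFun)
open import Data.Fin.Properties
  using (toℕ-injective; toℕ-fromℕ<; toℕ<n; toℕ≤n; punchInᵢ≢i; finToFun-funToFin; pigeonhole)
open import Data.Integer as ℤ using (ℤ; +_; -[1+_])
import Data.Integer.Properties as ℤ
import Algebra.Properties.AbelianGroup ℤ.+-0-abelianGroup as ℤ-Group
open import Data.List using (List; []; _∷_; _++_; map; tabulate; [_])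
import Data.List.Properties as List
open import Data.List.Extrema ℤ.≤-totalOrder using (argmin; argmin-all; f[argmin]≤f[xs])
open import Data.List.Membership.Propositional using (_∈_)
open import Data.List.Membership.Propositional.Properties using (∈-map⁺)
open import Data.List.Relation.Unary.All as All using (All; []; _∷_)
import Data.List.Relation.Unary.All.Properties as All
open import Data.List.Relation.Unary.AllPairs as AllPairs using (AllPairs; []; _∷_)
import Data.List.Relation.Unary.AllPairs.Properties as AllPairs
open import Data.List.Relation.Unary.Any using (here; there)
open import Data.Nat as ℕ using (ℕ; zero; suc; NonZero; _∸_; _<_; _≥_)
import Data.Nat.Properties as ℕ
open import Data.Nat.Coprimality using (prime⇒coprime; coprime-Bézout)
open import Data.Nat.DivMod using (_mod_; _%_; %-distribˡ-+; %-distribˡ-*; m%n<n; m<n⇒m%n≡m; n%n≡0; [m+kn]%n≡m%n)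
open import Data.Nat.GCD using (module Bézout)
open import Data.Nat.Primality using (Prime)
open import Data.Product using (Σ; ∃; ∃₂; _×_; _,_; proj₁; proj₂; map₂)
open import Data.Sum using (_⊎_; inj₁; inj₂)
open import Data.Vec as Vec using ([]; _∷_)
open import Function using (_∘_; _on_; id)
open import Function.Definitions using (Injective)
open import Level using (0ℓ; _⊔_)
open import Relation.Binary.PropositionalEquality as ≡ using (_≡_; _≢_; _≗_)
import Relation.Binary.Reasoning.Setoid as SetoidReasoning
open import Relation.Nullary using (yes; no)

-- ℤ_p as a commutative ring

module _ {p : ℕ} .{{_ : NonZero p}} where
  open ≡ using (sym; trans; cong; cong₂)

  infix 8 -ₚ_
  -ₚ_ : Zp p → Zp p
  -ₚ a = (p ∸ toℕ a) mod p

  toℕ-mod : ∀ m → toℕ (m mod p) ≡ m % p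
  toℕ-mod m = toℕ-fromℕ< (m%n<n m p)

  mod-cong : ∀ {m n} → m % p ≡ n % p → m mod p ≡ n mod p
  mod-cong {m} {n} eq = toℕ-injective (trans (toℕ-mod m) (trans eq (sym (toℕ-mod n))))

  toℕ-mod-id : ∀ a → toℕ a mod p ≡ a
  toℕ-mod-id a = toℕ-injective (trans (toℕ-mod (toℕ a)) (m<n⇒m%n≡m (toℕ<n a)))

  -- _mod p is a surjective homomorphism from ℕ, so each law below is inherited from ℕ.
  mod-+ : ∀ m n → (m ℕ.+ n) mod p ≡ (m mod p) +ₚ (n mod p)
  mod-+ m n = mod-cong (trans (%-distribˡ-+ m n p)
    (sym (cong₂ (λ x y → (x ℕ.+ y) % p) (toℕ-mod m) (toℕ-mod n))))

  mod-* : ∀ m n → (m ℕ.* n) mod p ≡ (m mod p) *ₚ (n mod p)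
  mod-* m n = mod-cong (trans (%-distribˡ-* m n p)
    (sym (cong₂ (λ x y → (x ℕ.* y) % p) (toℕ-mod m) (toℕ-mod n))))

  mod-+ʳ : ∀ m b → (m ℕ.+ toℕ b) mod p ≡ (m mod p) +ₚ b
  mod-+ʳ m b = trans (mod-+ m (toℕ b)) (cong ((m mod p) +ₚ_) (toℕ-mod-id b))

  mod-+ˡ : ∀ a m → (toℕ a ℕ.+ m) mod p ≡ a +ₚ (m mod p)
  mod-+ˡ a m = trans (mod-+ (toℕ a) m) (cong (_+ₚ (m mod p)) (toℕ-mod-id a))

  mod-*ʳ : ∀ m b → (m ℕ.* toℕ b) mod p ≡ (m mod p) *ₚ b
  mod-*ʳ m b = trans (mod-* m (toℕ b)) (cong ((m mod p) *ₚ_) (toℕ-mod-id b))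

  mod-*ˡ : ∀ a m → (toℕ a ℕ.* m) mod p ≡ a *ₚ (m mod p)
  mod-*ˡ a m = trans (mod-* (toℕ a) m) (cong (_*ₚ (m mod p)) (toℕ-mod-id a))

  +ₚ-comm : ∀ a b → a +ₚ b ≡ b +ₚ a
  +ₚ-comm a b = cong (_mod p) (ℕ.+-comm (toℕ a) (toℕ b))

  *ₚ-comm : ∀ a b → a *ₚ b ≡ b *ₚ a
  *ₚ-comm a b = cong (_mod p) (ℕ.*-comm (toℕ a) (toℕ b))

  +ₚ-assoc : ∀ a b c → (a +ₚ b) +ₚ c ≡ a +ₚ (b +ₚ c)
  +ₚ-assoc a b c = trans (sym (mod-+ʳ (toℕ a ℕ.+ toℕ b) c))
    (trans (cong (_mod p) (ℕ.+-assoc (toℕ a) (toℕ b) (toℕ c))) (mod-+ˡ a (toℕ b ℕ.+ toℕ c)))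

  *ₚ-assoc : ∀ a b c → (a *ₚ b) *ₚ c ≡ a *ₚ (b *ₚ c)
  *ₚ-assoc a b c = trans (sym (mod-*ʳ (toℕ a ℕ.* toℕ b) c))
    (trans (cong (_mod p) (ℕ.*-assoc (toℕ a) (toℕ b) (toℕ c))) (mod-*ˡ a (toℕ b ℕ.* toℕ c)))

  *ₚ-distribˡ-+ₚ : ∀ a b c → a *ₚ (b +ₚ c) ≡ a *ₚ b +ₚ a *ₚ c
  *ₚ-distribˡ-+ₚ a b c = trans (sym (mod-*ˡ a (toℕ b ℕ.+ toℕ c)))
    (trans (cong (_mod p) (ℕ.*-distribˡ-+ (toℕ a) (toℕ b) (toℕ c))) (mod-+ _ _))

  +ₚ-identityˡ : ∀ a → 0ₚ +ₚ a ≡ a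
  +ₚ-identityˡ a = trans (sym (mod-+ʳ 0 a)) (toℕ-mod-id a)

  *ₚ-identityˡ : ∀ a → 1ₚ *ₚ a ≡ a
  *ₚ-identityˡ a = trans (sym (mod-*ʳ 1 a)) (trans (cong (_mod p) (ℕ.*-identityˡ (toℕ a))) (toℕ-mod-id a))

  -ₚ-inverseˡ : ∀ a → -ₚ a +ₚ a ≡ 0ₚ
  -ₚ-inverseˡ a = trans (sym (mod-+ʳ (p ∸ toℕ a) a))
    (mod-cong (trans (cong (_% p) (ℕ.m∸n+n≡m (toℕ≤n a)))
                     (trans (n%n≡0 p) (sym (m<n⇒m%n≡m (ℕ.>-nonZero⁻¹ p))))))

  Zp-isCommutativeRing : IsCommutativeRing _≡_ _+ₚ_ _*ₚ_ -ₚ_ 0ₚ 1ₚ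
  Zp-isCommutativeRing = record
    { isRing = record
      { +-isAbelianGroup = record
        { isGroup = record
          { isMonoid = record
            { isSemigroup = record
              { isMagma = record { isEquivalence = ≡.isEquivalence ; ∙-cong = cong₂ _+ₚ_ }
              ; assoc = +ₚ-assoc }
            ; identity = Consequences.comm∧idˡ⇒id +ₚ-comm +ₚ-identityˡ }
          ; inverse = Consequences.comm∧invˡ⇒inv +ₚ-comm -ₚ-inverseˡ
          ; ⁻¹-cong = cong -ₚ_ }
        ; comm = +ₚ-comm }
      ; *-cong = cong₂ _*ₚ_
      ; *-assoc = *ₚ-assoc
      ; *-identity = Consequences.comm∧idˡ⇒id *ₚ-comm *ₚ-identityˡ
      ; distrib = *ₚ-distribˡ-+ₚ , Consequences.comm∧distrˡ⇒distrʳ *ₚ-comm *ₚ-distribˡ-+ₚ }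
    ; *-comm = *ₚ-comm }

Zp-commutativeRing : (p : ℕ) .{{_ : NonZero p}} → CommutativeRing 0ℓ 0ℓ
Zp-commutativeRing p = record { isCommutativeRing = Zp-isCommutativeRing {p} }

module _ {p : ℕ} .{{_ : NonZero p}} where
  open ≡ using (cong)
  open ≡.≡-Reasoning
  open CommutativeRing (Zp-commutativeRing p) using (ring; +-abelianGroup)
  open import Algebra.Properties.Ring ring using (-‿distribˡ-*)
  open import Algebra.Properties.AbelianGroup +-abelianGroup using (inverseʳ-unique; ⁻¹-involutive)

  Zp-inverse : Prime p → ∀ a → toℕ a ≢ 0 → ∃ λ b → b *ₚ a ≡ 1ₚ
  Zp-inverse p-prime a a≢0 with coprime-Bézout (prime⇒coprime p-prime {{ℕ.≢-nonZero a≢0}} (toℕ<n a))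
  ... | Bézout.-+ x y eq = y mod p , (begin
    (y mod p) *ₚ a         ≡⟨ mod-*ʳ y a ⟨
    (y ℕ.* toℕ a) mod p    ≡⟨ cong (_mod p) eq ⟨
    (1 ℕ.+ x ℕ.* p) mod p  ≡⟨ mod-cong ([m+kn]%n≡m%n 1 x p) ⟩
    1ₚ ∎)
  ... | Bézout.+- x y eq = -ₚ (y mod p) , (begin
    -ₚ (y mod p) *ₚ a       ≡⟨ -‿distribˡ-* (y mod p) a ⟨
    -ₚ ((y mod p) *ₚ a)     ≡⟨ cong -ₚ_ (inverseʳ-unique 1ₚ _ 1+ya≡0) ⟩
    -ₚ -ₚ 1ₚ                ≡⟨ ⁻¹-involutive 1ₚ ⟩
    1ₚ ∎)
    where
    1+ya≡0 : 1ₚ +ₚ (y mod p) *ₚ a ≡ 0ₚ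
    1+ya≡0 = begin
      1ₚ +ₚ (y mod p) *ₚ a          ≡⟨ cong (1ₚ +ₚ_) (mod-*ʳ y a) ⟨
      1ₚ +ₚ (y ℕ.* toℕ a) mod p     ≡⟨ mod-+ 1 _ ⟨
      (1 ℕ.+ y ℕ.* toℕ a) mod p     ≡⟨ cong (_mod p) eq ⟩
      (x ℕ.* p) mod p               ≡⟨ mod-cong ([m+kn]%n≡m%n 0 x p) ⟩
      0ₚ ∎

-- Matrices over ℤ_p

module _ {p : ℕ} .{{_ : NonZero p}} where
  open ≡ using (refl; sym; trans; cong; cong₂)
  open ≡.≡-Reasoning
  private module R = CommutativeRing (Zp-commutativeRing p)
  open import Algebra.Properties.Semiring.Sum R.semiring
    using ( sum; sum-syntax; sum-cong-≗; ∑-comm; ∑-distrib-+; *-distribˡ-sum; *-distribʳ-sum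
          ; sum-remove; sum-replicate-zero)

  Σₚ≡sum : ∀ m (f : Fin m → Zp p) → Σₚ m f ≡ sum f
  Σₚ≡sum zero    f = refl
  Σₚ≡sum (suc m) f = cong (f Fin.zero +ₚ_) (Σₚ≡sum m (f ∘ Fin.suc))

  sum-select : ∀ {m} (f : Fin m → Zp p) i → (∀ j → j ≢ i → f j ≡ 0ₚ) → sum f ≡ f i
  sum-select {suc m} f i others≡0 = begin
    sum f                                ≡⟨ sum-remove f ⟩
    f i +ₚ sum (f ∘ punchIn i)           ≡⟨ cong (f i +ₚ_) (sum-cong-≗ (others≡0 _ ∘ punchInᵢ≢i i)) ⟩
    f i +ₚ sum {m} (λ _ → 0ₚ)            ≡⟨ cong (f i +ₚ_) (sum-replicate-zero m) ⟩
    f i +ₚ 0ₚ                            ≡⟨ R.+-identityʳ (f i) ⟩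
    f i ∎

  module _ {n : ℕ} where

    0M : Mat p n
    0M _ _ = 0ₚ

    1M : Mat p n
    1M = scalarI 1ₚ

    -M_ : Mat p n → Mat p n
    (-M A) r s = -ₚ A r s

    -V_ : ZVec p n → ZVec p n
    (-V v) r = -ₚ v r

    col : Mat p n → Fin n → ZVec p n
    col B s t = B t s

    ·≡sum : ∀ (A : Mat p n) v r → (A · v) r ≡ ∑[ t < n ] (A r t *ₚ v t)
    ·≡sum A v r = Σₚ≡sum n _

    ·-cong : ∀ {A B : Mat p n} {v w} → A ≈M B → v ≗ w → A · v ≗ B · w
    ·-cong {A} {B} {v} {w} A≈B v≗w r = begin
      (A · v) r                     ≡⟨ ·≡sum A v r ⟩
      ∑[ t < n ] (A r t *ₚ v t)     ≡⟨ sum-cong-≗ (λ t → cong₂ _*ₚ_ (A≈B r t) (v≗w t)) ⟩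
      ∑[ t < n ] (B r t *ₚ w t)     ≡⟨ ·≡sum B w r ⟨
      (B · w) r ∎

    ·-assoc : ∀ (A B : Mat p n) v → (A ⊗ B) · v ≗ A · (B · v)
    ·-assoc A B v r = begin
      ((A ⊗ B) · v) r
        ≡⟨ ·≡sum (A ⊗ B) v r ⟩
      ∑[ t < n ] ((A ⊗ B) r t *ₚ v t)
        ≡⟨ sum-cong-≗ (λ t → cong (_*ₚ v t) (·≡sum A (col B t) r)) ⟩
      ∑[ t < n ] (∑[ s < n ] (A r s *ₚ B s t) *ₚ v t)
        ≡⟨ sum-cong-≗ (λ t → *-distribʳ-sum (v t) (λ s → A r s *ₚ B s t)) ⟩
      ∑[ t < n ] ∑[ s < n ] (A r s *ₚ B s t *ₚ v t)
        ≡⟨ ∑-comm (λ t s → A r s *ₚ B s t *ₚ v t) ⟩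
      ∑[ s < n ] ∑[ t < n ] (A r s *ₚ B s t *ₚ v t)
        ≡⟨ sum-cong-≗ (λ s → sum-cong-≗ (λ t → R.*-assoc (A r s) (B s t) (v t))) ⟩
      ∑[ s < n ] ∑[ t < n ] (A r s *ₚ (B s t *ₚ v t))
        ≡⟨ sum-cong-≗ (λ s → *-distribˡ-sum (A r s) (λ t → B s t *ₚ v t)) ⟨
      ∑[ s < n ] (A r s *ₚ ∑[ t < n ] (B s t *ₚ v t))
        ≡⟨ sum-cong-≗ (λ s → cong (A r s *ₚ_) (·≡sum B v s)) ⟨
      ∑[ s < n ] (A r s *ₚ (B · v) s)
        ≡⟨ ·≡sum A (B · v) r ⟨
      (A · (B · v)) r ∎

    ·-distribˡ : ∀ (A : Mat p n) v w → A · (v ⊞ w) ≗ (A · v) ⊞ (A · w)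
    ·-distribˡ A v w r = begin
      (A · (v ⊞ w)) r
        ≡⟨ ·≡sum A (v ⊞ w) r ⟩
      ∑[ t < n ] (A r t *ₚ (v t +ₚ w t))
        ≡⟨ sum-cong-≗ (λ t → R.distribˡ (A r t) (v t) (w t)) ⟩
      ∑[ t < n ] (A r t *ₚ v t +ₚ A r t *ₚ w t)
        ≡⟨ ∑-distrib-+ (λ t → A r t *ₚ v t) _ ⟩
      ∑[ t < n ] (A r t *ₚ v t) +ₚ ∑[ t < n ] (A r t *ₚ w t)
        ≡⟨ cong₂ _+ₚ_ (·≡sum A v r) (·≡sum A w r) ⟨
      (A · v) r +ₚ (A · w) r ∎

    ·-distribʳ : ∀ (A B : Mat p n) v → (A ⊕ B) · v ≗ (A · v) ⊞ (B · v)
    ·-distribʳ A B v r = begin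
      ((A ⊕ B) · v) r
        ≡⟨ ·≡sum (A ⊕ B) v r ⟩
      ∑[ t < n ] ((A r t +ₚ B r t) *ₚ v t)
        ≡⟨ sum-cong-≗ (λ t → R.distribʳ (v t) (A r t) (B r t)) ⟩
      ∑[ t < n ] (A r t *ₚ v t +ₚ B r t *ₚ v t)
        ≡⟨ ∑-distrib-+ (λ t → A r t *ₚ v t) _ ⟩
      ∑[ t < n ] (A r t *ₚ v t) +ₚ ∑[ t < n ] (B r t *ₚ v t)
        ≡⟨ cong₂ _+ₚ_ (·≡sum A v r) (·≡sum B v r) ⟨
      (A · v) r +ₚ (B · v) r ∎

    ·-zeroˡ : ∀ v → 0M · v ≗ zeroV
    ·-zeroˡ v r = begin
      (0M · v) r                ≡⟨ ·≡sum 0M v r ⟩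
      ∑[ t < n ] (0ₚ *ₚ v t)    ≡⟨ sum-cong-≗ (λ t → R.zeroˡ (v t)) ⟩
      sum {n} (λ _ → 0ₚ)        ≡⟨ sum-replicate-zero n ⟩
      0ₚ ∎

    ·-zeroʳ : ∀ (A : Mat p n) → A · zeroV ≗ zeroV
    ·-zeroʳ A r = begin
      (A · zeroV) r              ≡⟨ ·≡sum A zeroV r ⟩
      ∑[ t < n ] (A r t *ₚ 0ₚ)   ≡⟨ sum-cong-≗ (λ t → R.zeroʳ (A r t)) ⟩
      sum {n} (λ _ → 0ₚ)         ≡⟨ sum-replicate-zero n ⟩
      0ₚ ∎

    scalarI-diagonal : ∀ x (r : Fin n) → scalarI x r r ≡ x
    scalarI-diagonal x r with r Fin.≟ r
    ... | yes _   = refl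
    ... | no  r≢r = ⊥-elim (r≢r refl)

    scalarI-off-diagonal : ∀ x {r s : Fin n} → r ≢ s → scalarI x r s ≡ 0ₚ
    scalarI-off-diagonal x {r} {s} r≢s with r Fin.≟ s
    ... | yes r≡s = ⊥-elim (r≢s r≡s)
    ... | no  _   = refl

    scalarI-· : ∀ x v → scalarI x · v ≗ λ r → x *ₚ v r
    scalarI-· x v r = begin
      (scalarI x · v) r                  ≡⟨ ·≡sum (scalarI x) v r ⟩
      ∑[ t < n ] (scalarI x r t *ₚ v t)  ≡⟨ sum-select _ r off-diagonal ⟩
      scalarI x r r *ₚ v r               ≡⟨ cong (_*ₚ v r) (scalarI-diagonal x r) ⟩
      x *ₚ v r ∎
      where
      off-diagonal : ∀ t → t ≢ r → scalarI x r t *ₚ v t ≡ 0ₚ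
      off-diagonal t t≢r = trans (cong (_*ₚ v t) (scalarI-off-diagonal x (t≢r ∘ sym))) (R.zeroˡ (v t))

    ⊗-scalarI : ∀ (A : Mat p n) x → (A ⊗ scalarI x) ≈M (λ r s → A r s *ₚ x)
    ⊗-scalarI A x r s = begin
      (A ⊗ scalarI x) r s                  ≡⟨ ·≡sum A (col (scalarI x) s) r ⟩
      ∑[ t < n ] (A r t *ₚ scalarI x t s)  ≡⟨ sum-select _ s off-diagonal ⟩
      A r s *ₚ scalarI x s s               ≡⟨ cong (A r s *ₚ_) (scalarI-diagonal x s) ⟩
      A r s *ₚ x ∎
      where
      off-diagonal : ∀ t → t ≢ s → A r t *ₚ scalarI x t s ≡ 0ₚ
      off-diagonal t t≢s = trans (cong (A r t *ₚ_) (scalarI-off-diagonal x t≢s)) (R.zeroʳ (A r t))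

    scalarI-central : ∀ x (A : Mat p n) → Commute (scalarI x) A
    scalarI-central x A r s =
      trans (scalarI-· x (col A s) r) (trans (R.*-comm x (A r s)) (sym (⊗-scalarI A x r s)))

    scalarI-⊗ : ∀ x y → (scalarI x ⊗ scalarI y) ≈M scalarI (x *ₚ y)
    scalarI-⊗ x y r s with r Fin.≟ s
    ... | yes ≡.refl = trans (scalarI-· x (col (scalarI y) s) r) (cong (x *ₚ_) (scalarI-diagonal y r))
    ... | no  r≢s    = trans (scalarI-· x (col (scalarI y) s) r)
                             (trans (cong (x *ₚ_) (scalarI-off-diagonal y r≢s)) (R.zeroʳ x))

    private
      ZVec-isAbelianGroup : IsAbelianGroup _≗_ _⊞_ zeroV -V_
      ZVec-isAbelianGroup = Pointwise.isAbelianGroup (Fin n) R.+-isAbelianGroup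

    Mat-ring : Ring 0ℓ 0ℓ
    Mat-ring = record
      { Carrier = Mat p n
      ; _≈_ = _≈M_
      ; _+_ = _⊕_
      ; _*_ = _⊗_
      ; -_ = -M_
      ; 0# = 0M
      ; 1# = 1M
      ; isRing = record
        { +-isAbelianGroup = Pointwise.isAbelianGroup (Fin n) ZVec-isAbelianGroup
        ; *-cong = λ A≈B C≈D r s → ·-cong A≈B (λ t → C≈D t s) r
        ; *-assoc = λ A B C r s → ·-assoc A B (col C s) r
        ; *-identity = (λ A r s → trans (scalarI-· 1ₚ (col A s) r) (R.*-identityˡ (A r s)))
                     , (λ A r s → trans (⊗-scalarI A 1ₚ r s) (R.*-identityʳ (A r s)))
        ; distrib = (λ A B C r s → ·-distribˡ A (col B s) (col C s) r)
                  , (λ A B C r s → ·-distribʳ B C (col A s) r)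
        }
      }

    ZVec-leftModule : LeftModule Mat-ring 0ℓ 0ℓ
    ZVec-leftModule = record
      { Carrierᴹ = ZVec p n
      ; _≈ᴹ_ = _≗_
      ; _+ᴹ_ = _⊞_
      ; _*ₗ_ = _·_
      ; 0ᴹ = zeroV
      ; -ᴹ_ = -V_
      ; isLeftModule = record
        { isLeftSemimodule = record
          { +ᴹ-isCommutativeMonoid = IsAbelianGroup.isCommutativeMonoid ZVec-isAbelianGroup
          ; isPreleftSemimodule = record
            { *ₗ-cong = ·-cong
            ; *ₗ-zeroˡ = ·-zeroˡ
            ; *ₗ-distribʳ = λ v A B → ·-distribʳ A B v
            ; *ₗ-identityˡ = λ v r → trans (scalarI-· 1ₚ v r) (R.*-identityˡ (v r))
            ; *ₗ-assoc = ·-assoc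
            ; *ₗ-zeroʳ = ·-zeroʳ
            ; *ₗ-distribˡ = ·-distribˡ
            }
          }
        ; -ᴹ‿cong = IsAbelianGroup.⁻¹-cong ZVec-isAbelianGroup
        ; -ᴹ‿inverse = IsAbelianGroup.inverse ZVec-isAbelianGroup
        }
      }

    private
      encode : Mat p n → Fin ((p ℕ.^ n) ℕ.^ n)
      encode A = funToFin (λ r → funToFin (A r))

      decode-encode : ∀ (A : Mat p n) r s → finToFun (finToFun (encode A) r) s ≡ A r s
      decode-encode A r s = trans (cong (λ row → finToFun row s) (finToFun-funToFin (λ r → funToFin (A r)) r))
                                  (finToFun-funToFin (A r) s)

    Mat-pigeonhole : (f : ℕ → Mat p n) → ∃₂ λ a b → a < b × f a ≈M f b
    Mat-pigeonhole f with pigeonhole (ℕ.n<1+n _) (λ i → encode (f (toℕ i)))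
    ... | i , j , i<j , same-code = toℕ i , toℕ j , i<j , λ r s →
      trans (sym (decode-encode (f (toℕ i)) r s))
            (trans (cong (λ code → finToFun (finToFun code r) s) same-code) (decode-encode (f (toℕ j)) r s))

-- Idempotents in commutative rings

module Idempotents {c ℓ} (R : CommutativeRing c ℓ) where
  open CommutativeRing R
  open import Algebra.Definitions _≈_ using (_IdempotentOn_)
  open import Algebra.Properties.Semiring.Exp semiring using (_^_; ^-congʳ; ^-homo-*)
  open import Algebra.Properties.Ring ring using (-0#≈0#; x[y-z]≈xy-xz; [y-z]x≈yx-zx)
  open import Algebra.Solver.Ring.NaturalCoefficients.Default commutativeSemiring using (solve; _:+_; _:*_; _:=_)
  open SetoidReasoning setoid

  ^-periodic : ∀ x {a d} → x ^ a ≈ x ^ (a ℕ.+ d) → ∀ r k → x ^ (r ℕ.+ (a ℕ.+ k ℕ.* d)) ≈ x ^ (r ℕ.+ a)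
  ^-periodic x {a} {d} period r k = begin
    x ^ (r ℕ.+ (a ℕ.+ k ℕ.* d))     ≈⟨ ^-homo-* x r _ ⟩
    x ^ r * x ^ (a ℕ.+ k ℕ.* d)     ≈⟨ *-congˡ (cycle k) ⟩
    x ^ r * x ^ a                   ≈⟨ ^-homo-* x r a ⟨
    x ^ (r ℕ.+ a) ∎
    where
    cycle : ∀ k → x ^ (a ℕ.+ k ℕ.* d) ≈ x ^ a
    cycle zero    = ^-congʳ x (ℕ.+-identityʳ a)
    cycle (suc k) = begin
      x ^ (a ℕ.+ (d ℕ.+ k ℕ.* d))   ≈⟨ ^-congʳ x (≡.sym (ℕ.+-assoc a d _)) ⟩
      x ^ (a ℕ.+ d ℕ.+ k ℕ.* d)     ≈⟨ ^-homo-* x (a ℕ.+ d) _ ⟩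
      x ^ (a ℕ.+ d) * x ^ (k ℕ.* d) ≈⟨ *-congʳ period ⟨
      x ^ a * x ^ (k ℕ.* d)         ≈⟨ ^-homo-* x a _ ⟨
      x ^ (a ℕ.+ k ℕ.* d)           ≈⟨ cycle k ⟩
      x ^ a ∎

  -- The powers of x are periodic from a on, with period d = b - a; the exponent (1 + a) d lies beyond a
  -- and is a multiple of d.
  idempotent-power : ∀ x {a b} → x ^ a ≈ x ^ b → a ℕ.< b → ∃ λ t → _*_ IdempotentOn (x ^ suc t)
  idempotent-power x {a} xᵃ≈xᵇ a<b with ℕ.m≤n⇒∃[o]m+o≡n a<b
  ... | o , 1+a+o≡b with ℕ.m≤n⇒∃[o]m+o≡n (ℕ.<⇒≤ (ℕ.m≤m*n (suc a) (suc o)))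
  ... | r , a+r≡N = o ℕ.+ a ℕ.* suc o , (begin
    x ^ N * x ^ N            ≈⟨ ^-homo-* x N N ⟨
    x ^ (N ℕ.+ N)            ≈⟨ ^-congʳ x N+N≡r+[a+N] ⟩
    x ^ (r ℕ.+ (a ℕ.+ N))    ≈⟨ ^-periodic x period r (suc a) ⟩
    x ^ (r ℕ.+ a)            ≈⟨ ^-congʳ x (≡.trans (ℕ.+-comm r a) a+r≡N) ⟩
    x ^ N ∎)
    where
    N : ℕ
    N = suc a ℕ.* suc o
    period : x ^ a ≈ x ^ (a ℕ.+ suc o)
    period = trans xᵃ≈xᵇ (^-congʳ x (≡.sym (≡.trans (ℕ.+-suc a o) 1+a+o≡b)))
    N+N≡r+[a+N] : N ℕ.+ N ≡ r ℕ.+ (a ℕ.+ N)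
    N+N≡r+[a+N] = ≡.trans (≡.cong (ℕ._+ N) (≡.trans (≡.sym a+r≡N) (ℕ.+-comm a r))) (ℕ.+-assoc r a N)

  IdempotentPowers : Set (c ⊔ ℓ)
  IdempotentPowers = ∀ x → ∃ λ t → _*_ IdempotentOn (x ^ suc t)

  InvertibleOn : Carrier → Carrier → Set (c ⊔ ℓ)
  InvertibleOn e a = ∃ λ b → a * b * e ≈ e

  invertibleOn-* : ∀ {e a} f → InvertibleOn e a → InvertibleOn (e * f) a
  invertibleOn-* {e} {a} f (b , abe≈e) = b , trans (sym (*-assoc (a * b) e f)) (*-congʳ abe≈e)

  idempotentOn-* : ∀ {e f} → _*_ IdempotentOn e → _*_ IdempotentOn f → _*_ IdempotentOn (e * f)
  idempotentOn-* {e} {f} ee≈e ff≈f = begin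
    e * f * (e * f)  ≈⟨ solve 2 (λ e f → e :* f :* (e :* f) := e :* e :* (f :* f)) refl e f ⟩
    e * e * (f * f)  ≈⟨ *-cong ee≈e ff≈f ⟩
    e * f ∎

  e*[1-e]≈0 : ∀ {e} → _*_ IdempotentOn e → e * (1# - e) ≈ 0#
  e*[1-e]≈0 {e} ee≈e = begin
    e * (1# - e)      ≈⟨ x[y-z]≈xy-xz e 1# e ⟩
    e * 1# - e * e    ≈⟨ +-cong (*-identityʳ e) (-‿cong ee≈e) ⟩
    e - e             ≈⟨ -‿inverseʳ e ⟩
    0# ∎

  complement-idempotent : ∀ {e} → _*_ IdempotentOn e → _*_ IdempotentOn (1# - e)
  complement-idempotent {e} ee≈e = begin
    (1# - e) * (1# - e)
      ≈⟨ [y-z]x≈yx-zx (1# - e) 1# e ⟩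
    1# * (1# - e) - e * (1# - e)
      ≈⟨ +-cong (*-identityˡ (1# - e)) (-‿cong (e*[1-e]≈0 ee≈e)) ⟩
    (1# - e) - 0#
      ≈⟨ +-congˡ -0#≈0# ⟩
    (1# - e) + 0#
      ≈⟨ +-identityʳ (1# - e) ⟩
    1# - e ∎

  x≈xe+x[1-e] : ∀ x e → x ≈ x * e + x * (1# - e)
  x≈xe+x[1-e] x e = sym (begin
    x * e + x * (1# - e)
      ≈⟨ distribˡ x e (1# - e) ⟨
    x * (e + (1# - e))
      ≈⟨ *-congˡ (trans (+-comm e (1# - e)) (trans (+-assoc 1# (- e) e) (+-congˡ (-‿inverseˡ e)))) ⟩
    x * (1# + 0#)
      ≈⟨ *-congˡ (+-identityʳ 1#) ⟩
    x * 1#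
      ≈⟨ *-identityʳ x ⟩
    x ∎)

  unroll-recurrence : ∀ {e x y} → e ≈ x * e + y → ∀ k → ∃ λ z → e ≈ x ^ k * e + z * y
  unroll-recurrence {e} {x} {y} e≈xe+y zero = 0# , (begin
    e                ≈⟨ *-identityˡ e ⟨
    1# * e           ≈⟨ +-identityʳ (1# * e) ⟨
    1# * e + 0#      ≈⟨ +-congˡ (zeroˡ y) ⟨
    1# * e + 0# * y ∎)
  unroll-recurrence {e} {x} {y} e≈xe+y (suc k) with unroll-recurrence e≈xe+y k
  ... | z , e≈xᵏe+zy = x ^ k + z , (begin
    e
      ≈⟨ e≈xᵏe+zy ⟩
    x ^ k * e + z * y
      ≈⟨ +-congʳ (*-congˡ e≈xe+y) ⟩
    x ^ k * (x * e + y) + z * y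
      ≈⟨ solve 5 (λ x y e xᵏ z → xᵏ :* (x :* e :+ y) :+ z :* y := x :* xᵏ :* e :+ (xᵏ :+ z) :* y)
                 refl x y e (x ^ k) z ⟩
    x * x ^ k * e + (x ^ k + z) * y ∎)

  absorb-nilpotent : ∀ {e x y} t → x ^ t * e ≈ 0# → e ≈ x * e + y → ∃ λ z → e ≈ z * y
  absorb-nilpotent {e} {x} {y} t xᵗe≈0 e≈xe+y with unroll-recurrence e≈xe+y t
  ... | z , e≈xᵗe+zy = z , (begin
    e                  ≈⟨ e≈xᵗe+zy ⟩
    x ^ t * e + z * y  ≈⟨ +-congʳ xᵗe≈0 ⟩
    0# + z * y         ≈⟨ +-identityˡ (z * y) ⟩
    z * y ∎)

  power-invertibleOn : ∀ {x} t e → _*_ IdempotentOn (x ^ suc t) → InvertibleOn (e * x ^ suc t) x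
  power-invertibleOn {x} t e EE≈E = x ^ t , (begin
    x * x ^ t * (e * x ^ suc t)   ≈⟨ solve 2 (λ e E → E :* (e :* E) := e :* (E :* E)) refl e (x ^ suc t) ⟩
    e * (x ^ suc t * x ^ suc t)   ≈⟨ *-congˡ EE≈E ⟩
    e * x ^ suc t ∎)

  e*[f*[1-e]]≈0 : ∀ {e} f → _*_ IdempotentOn e → e * (f * (1# - e)) ≈ 0#
  e*[f*[1-e]]≈0 {e} f ee≈e = begin
    e * (f * (1# - e))  ≈⟨ solve 3 (λ e f g → e :* (f :* g) := f :* (e :* g)) refl e f (1# - e) ⟩
    f * (e * (1# - e))  ≈⟨ *-congˡ (e*[1-e]≈0 ee≈e) ⟩
    f * 0#              ≈⟨ zeroʳ f ⟩
    0# ∎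

-- Bicommutants

module _ {c ℓ i} (R : Ring c ℓ) {I : Set i} where
  open Ring R
  open import Algebra.Properties.Ring R using (-‿distribˡ-*; -‿distribʳ-*)
  open SetoidReasoning setoid

  module Bicommutant (S : I → Carrier) (S-comm : ∀ i j → S i * S j ≈ S j * S i) where

    InCommutant : Carrier → Set (ℓ ⊔ i)
    InCommutant y = ∀ i → S i * y ≈ y * S i

    InBicommutant : Carrier → Set (c ⊔ ℓ ⊔ i)
    InBicommutant x = ∀ y → InCommutant y → x * y ≈ y * x

    Element : Set (c ⊔ ℓ ⊔ i)
    Element = Σ Carrier InBicommutant

    embed : I → Element
    embed i = S i , λ y y∈S′ → y∈S′ i

    central : ∀ x → (∀ y → x * y ≈ y * x) → Element
    central x x-central = x , λ y _ → x-central y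

    private
      _≈″_ : Element → Element → Set ℓ
      _≈″_ = _≈_ on proj₁

      0″ : Element
      0″ = 0# , λ y _ → trans (zeroˡ y) (sym (zeroʳ y))

      1″ : Element
      1″ = 1# , λ y _ → trans (*-identityˡ y) (sym (*-identityʳ y))

      _+″_ : Element → Element → Element
      (x , x″) +″ (x′ , x′″) = x + x′ , λ y y∈S′ → begin
        (x + x′) * y      ≈⟨ distribʳ y x x′ ⟩
        x * y + x′ * y    ≈⟨ +-cong (x″ y y∈S′) (x′″ y y∈S′) ⟩
        y * x + y * x′    ≈⟨ distribˡ y x x′ ⟨
        y * (x + x′) ∎

      _*″_ : Element → Element → Element
      (x , x″) *″ (x′ , x′″) = x * x′ , λ y y∈S′ → begin
        x * x′ * y        ≈⟨ *-assoc x x′ y ⟩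
        x * (x′ * y)      ≈⟨ *-congˡ (x′″ y y∈S′) ⟩
        x * (y * x′)      ≈⟨ *-assoc x y x′ ⟨
        x * y * x′        ≈⟨ *-congʳ (x″ y y∈S′) ⟩
        y * x * x′        ≈⟨ *-assoc y x x′ ⟩
        y * (x * x′) ∎

      -″_ : Element → Element
      -″ (x , x″) = - x , λ y y∈S′ → begin
        - x * y           ≈⟨ -‿distribˡ-* x y ⟨
        - (x * y)         ≈⟨ -‿cong (x″ y y∈S′) ⟩
        - (y * x)         ≈⟨ -‿distribʳ-* y x ⟩
        y * - x ∎

      -- An element of the bicommutant commutes with each S i, so it lies in the commutant.
      *″-comm : ∀ x x′ → (x *″ x′) ≈″ (x′ *″ x)
      *″-comm (x , x″) (x′ , x′″) = x″ x′ λ i → sym (x′″ (S i) (λ j → S-comm j i))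

      rawRing″ : RawRing (c ⊔ ℓ ⊔ i) ℓ
      rawRing″ = record { _≈_ = _≈″_ ; _+_ = _+″_ ; _*_ = _*″_ ; -_ = -″_ ; 0# = 0″ ; 1# = 1″ }

      proj₁-isRingMonomorphism : IsRingMonomorphism rawRing″ rawRing proj₁
      proj₁-isRingMonomorphism = record
        { isRingHomomorphism = record
          { isSemiringHomomorphism = record
            { isNearSemiringHomomorphism = record
              { +-isMonoidHomomorphism = record
                { isMagmaHomomorphism = record
                  { isRelHomomorphism = record { cong = id }
                  ; homo = λ _ _ → refl }
                ; ε-homo = refl }
              ; *-homo = λ _ _ → refl }
            ; 1#-homo = refl }
          ; -‿homo = λ _ → refl }
        ; injective = id }

    commutativeRing : CommutativeRing (c ⊔ ℓ ⊔ i) ℓ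
    commutativeRing = record
      { isCommutativeRing = record
        { isRing = RingMonomorphism.isRing proj₁-isRingMonomorphism isRing
        ; *-comm = *″-comm } }

    leftModule : ∀ {m ℓm} → LeftModule R m ℓm → LeftModule (CommutativeRing.ring commutativeRing) m ℓm
    leftModule V = record
      { _*ₗ_ = λ x v → proj₁ x *ₗ v
      ; isLeftModule = record
        { isLeftSemimodule = record
          { +ᴹ-isCommutativeMonoid = +ᴹ-isCommutativeMonoid
          ; isPreleftSemimodule = record
            { *ₗ-cong = *ₗ-cong
            ; *ₗ-zeroˡ = *ₗ-zeroˡ
            ; *ₗ-distribʳ = λ v x y → *ₗ-distribʳ v (proj₁ x) (proj₁ y)
            ; *ₗ-identityˡ = *ₗ-identityˡ
            ; *ₗ-assoc = λ x y → *ₗ-assoc (proj₁ x) (proj₁ y)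
            ; *ₗ-zeroʳ = λ x → *ₗ-zeroʳ (proj₁ x)
            ; *ₗ-distribˡ = λ x → *ₗ-distribˡ (proj₁ x) } }
        ; -ᴹ‿cong = -ᴹ‿cong
        ; -ᴹ‿inverse = -ᴹ‿inverse } }
      where open LeftModule V

-- Additive cellular automata over a module

-- Course-of-values recursion on ℤ: fix is init below 0, and fix (+ k) is step k applied to history k,
-- which agrees with fix below + k.
module CourseOfValues {a} {A : Set a} (init : A) (step : ℕ → (ℤ → A) → A) where

  history : ℕ → ℤ → A
  history zero    _ = init
  history (suc k) y with y ℤ.≟ + k
  ... | yes _ = step k (history k)
  ... | no  _ = history k y

  fix : ℤ → A
  fix (+ k)    = step k (history k)
  fix -[1+ _ ] = init

  fix-negative : ∀ {y} → y ℤ.< + 0 → fix y ≡ init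
  fix-negative { -[1+ _ ]} _           = ≡.refl
  fix-negative { + _ }     (ℤ.+<+ ())

  history-agrees : ∀ k {y} → y ℤ.< + k → history k y ≡ fix y
  history-agrees zero    y<0 = ≡.sym (fix-negative y<0)
  history-agrees (suc k) {y} y<1+k with y ℤ.≟ + k
  ... | yes ≡.refl = ≡.refl
  ... | no  y≢k    = history-agrees k (ℤ.≤∧≢⇒< (<1+⇒≤ y<1+k) y≢k)
    where
    <1+⇒≤ : ∀ {y k} → y ℤ.< + suc k → y ℤ.≤ + k
    <1+⇒≤ { -[1+ _ ]} ℤ.-<+          = ℤ.-≤+
    <1+⇒≤ { + _ }     (ℤ.+<+ j<1+k)  = ℤ.+≤+ (ℕ.s≤s⁻¹ j<1+k)

module CellularAutomaton {r ℓr m ℓm} (R : CommutativeRing r ℓr) (V : LeftModule (CommutativeRing.ring R) m ℓm)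
  where
  open CommutativeRing R
  open LeftModule V
  open Idempotents R
  open import Algebra.Definitions _≈_ using (_IdempotentOn_)
  open import Algebra.Properties.Semiring.Exp semiring using (_^_; ^-congʳ)
  open import Algebra.Properties.CommutativeSemiring.Exp commutativeSemiring using (^-distrib-*)
  open import Algebra.Properties.CommutativeSemigroup +-commutativeSemigroup
    using () renaming (x∙yz≈y∙xz to +-x∙yz≈y∙xz)
  open import Algebra.Properties.Semiring.Sum semiring using (sum-syntax)
  open import Algebra.Solver.Ring.NaturalCoefficients.Default commutativeSemiring using (solve; _:+_; _:*_; _:=_)
  open import Algebra.Properties.CommutativeSemigroup (CommutativeMonoid.commutativeSemigroup +ᴹ-commutativeMonoid)
    using (interchange; x∙yz≈y∙xz)
  open import Algebra.Properties.AbelianGroup +ᴹ-abelianGroup using (xyx⁻¹≈y; //-rightDividesˡ; inverseʳ-unique)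
  module ≈-Reasoning = SetoidReasoning setoid
  module ≈ᴹ-Reasoning = SetoidReasoning ≈ᴹ-setoid

  -- A polynomial Σ aᵢ X^uᵢ is the list of its terms (aᵢ , uᵢ); ⟦ ts ⟧ is the automaton c ↦ h c.
  Term : ℕ → Set r
  Term d = Carrier × Point d

  Conf : ℕ → Set m
  Conf d = Point d → Carrierᴹ

  Distinct : ∀ {d} → List (Term d) → Set r
  Distinct = AllPairs (_≢_ on proj₂)

  ⟦_⟧ : ∀ {d} → List (Term d) → Conf d → Conf d
  ⟦ [] ⟧           c v = 0ᴹ
  ⟦ (a , u) ∷ ts ⟧ c v = a *ₗ c (v -ᵖ u) +ᴹ ⟦ ts ⟧ c v

  ⟦⟧-cong : ∀ {d} (ts : List (Term d)) {c c′} v →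
            All (λ t → c (v -ᵖ proj₂ t) ≈ᴹ c′ (v -ᵖ proj₂ t)) ts → ⟦ ts ⟧ c v ≈ᴹ ⟦ ts ⟧ c′ v
  ⟦⟧-cong []       v []            = ≈ᴹ-refl
  ⟦⟧-cong (t ∷ ts) v (c≈c′ ∷ cs≈) = +ᴹ-cong (*ₗ-congˡ c≈c′) (⟦⟧-cong ts v cs≈)

  ⟦⟧-congʳ : ∀ {d} (ts : List (Term d)) {c c′} → (∀ x → c x ≈ᴹ c′ x) → ∀ v → ⟦ ts ⟧ c v ≈ᴹ ⟦ ts ⟧ c′ v
  ⟦⟧-congʳ ts c≈c′ v = ⟦⟧-cong ts v (All.universal (λ t → c≈c′ (v -ᵖ proj₂ t)) ts)

  ⟦⟧-zero : ∀ {d} (ts : List (Term d)) v → ⟦ ts ⟧ (λ _ → 0ᴹ) v ≈ᴹ 0ᴹ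
  ⟦⟧-zero []             v = ≈ᴹ-refl
  ⟦⟧-zero ((a , u) ∷ ts) v = ≈ᴹ-trans (+ᴹ-cong (*ₗ-zeroʳ a) (⟦⟧-zero ts v)) (+ᴹ-identityˡ 0ᴹ)

  ⟦⟧-+ᴹ : ∀ {d} (ts : List (Term d)) c c′ v → ⟦ ts ⟧ (λ x → c x +ᴹ c′ x) v ≈ᴹ ⟦ ts ⟧ c v +ᴹ ⟦ ts ⟧ c′ v
  ⟦⟧-+ᴹ []             c c′ v = ≈ᴹ-sym (+ᴹ-identityˡ 0ᴹ)
  ⟦⟧-+ᴹ ((a , u) ∷ ts) c c′ v = begin
    a *ₗ (c x +ᴹ c′ x) +ᴹ ⟦ ts ⟧ (λ x → c x +ᴹ c′ x) v
      ≈⟨ +ᴹ-cong (*ₗ-distribˡ a (c x) (c′ x)) (⟦⟧-+ᴹ ts c c′ v) ⟩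
    (a *ₗ c x +ᴹ a *ₗ c′ x) +ᴹ (⟦ ts ⟧ c v +ᴹ ⟦ ts ⟧ c′ v)
      ≈⟨ interchange _ _ _ _ ⟩
    (a *ₗ c x +ᴹ ⟦ ts ⟧ c v) +ᴹ (a *ₗ c′ x +ᴹ ⟦ ts ⟧ c′ v) ∎
    where
    open ≈ᴹ-Reasoning
    x = v -ᵖ u

  *ₗ-comm : ∀ a b x → a *ₗ b *ₗ x ≈ᴹ b *ₗ a *ₗ x
  *ₗ-comm a b x = ≈ᴹ-trans (≈ᴹ-sym (*ₗ-assoc a b x)) (≈ᴹ-trans (*ₗ-congʳ (*-comm a b)) (*ₗ-assoc b a x))

  ⟦⟧-*ₗ : ∀ {d} (ts : List (Term d)) b c v → ⟦ ts ⟧ (λ x → b *ₗ c x) v ≈ᴹ b *ₗ ⟦ ts ⟧ c v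
  ⟦⟧-*ₗ []             b c v = ≈ᴹ-sym (*ₗ-zeroʳ b)
  ⟦⟧-*ₗ ((a , u) ∷ ts) b c v = begin
    a *ₗ b *ₗ c x +ᴹ ⟦ ts ⟧ (λ x → b *ₗ c x) v   ≈⟨ +ᴹ-cong (*ₗ-comm a b (c x)) (⟦⟧-*ₗ ts b c v) ⟩
    b *ₗ a *ₗ c x +ᴹ b *ₗ ⟦ ts ⟧ c v             ≈⟨ *ₗ-distribˡ b _ _ ⟨
    b *ₗ (a *ₗ c x +ᴹ ⟦ ts ⟧ c v) ∎
    where
    open ≈ᴹ-Reasoning
    x = v -ᵖ u

  ⟦⟧-insert : ∀ {d} (I : List (Term d)) a u ts c v →
              ⟦ I ++ (a , u) ∷ ts ⟧ c v ≈ᴹ a *ₗ c (v -ᵖ u) +ᴹ ⟦ I ++ ts ⟧ c v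
  ⟦⟧-insert []            a u ts c v = ≈ᴹ-refl
  ⟦⟧-insert ((b , w) ∷ I) a u ts c v = ≈ᴹ-trans (+ᴹ-congˡ (⟦⟧-insert I a u ts c v)) (x∙yz≈y∙xz _ _ _)

  -ᴹ‿distribʳ-*ₗ : ∀ a x → -ᴹ (a *ₗ x) ≈ᴹ a *ₗ -ᴹ x
  -ᴹ‿distribʳ-*ₗ a x = ≈ᴹ-sym (inverseʳ-unique (a *ₗ x) (a *ₗ -ᴹ x) (begin
    a *ₗ x +ᴹ a *ₗ -ᴹ x   ≈⟨ *ₗ-distribˡ a x (-ᴹ x) ⟨
    a *ₗ (x +ᴹ -ᴹ x)      ≈⟨ *ₗ-congˡ (-ᴹ‿inverseʳ x) ⟩
    a *ₗ 0ᴹ               ≈⟨ *ₗ-zeroʳ a ⟩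
    0ᴹ ∎))
    where open ≈ᴹ-Reasoning

  Solution : ∀ {d} → Carrier → List (Term d) → Conf d → Set (m ⊔ ℓm)
  Solution P ts e = ∃ λ c → ∀ v → ⟦ ts ⟧ c v ≈ᴹ P *ₗ e v

  Solvable : ∀ {d} → Carrier → List (Term d) → Set (m ⊔ ℓm)
  Solvable P ts = ∀ e → Solution P ts e

  solvable-zero : ∀ {d P} (ts : List (Term d)) → P ≈ 0# → Solvable P ts
  solvable-zero {P = P} ts P≈0 e = (λ _ → 0ᴹ) , λ v → begin
    ⟦ ts ⟧ (λ _ → 0ᴹ) v   ≈⟨ ⟦⟧-zero ts v ⟩
    0ᴹ                    ≈⟨ *ₗ-zeroˡ (e v) ⟨
    0# *ₗ e v             ≈⟨ *ₗ-congʳ P≈0 ⟨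
    P *ₗ e v ∎
    where open ≈ᴹ-Reasoning

  solvable-resp : ∀ {d P Q} (ts : List (Term d)) → P ≈ Q → Solvable P ts → Solvable Q ts
  solvable-resp ts P≈Q S e with S e
  ... | c , c-solves = c , λ v → ≈ᴹ-trans (c-solves v) (*ₗ-congʳ P≈Q)

  solvable-+ : ∀ {d P Q} (ts : List (Term d)) → Solvable P ts → Solvable Q ts → Solvable (P + Q) ts
  solvable-+ {P = P} {Q} ts S₁ S₂ e with S₁ e | S₂ e
  ... | c₁ , c₁-solves | c₂ , c₂-solves = (λ x → c₁ x +ᴹ c₂ x) , λ v → begin
    ⟦ ts ⟧ (λ x → c₁ x +ᴹ c₂ x) v   ≈⟨ ⟦⟧-+ᴹ ts c₁ c₂ v ⟩
    ⟦ ts ⟧ c₁ v +ᴹ ⟦ ts ⟧ c₂ v      ≈⟨ +ᴹ-cong (c₁-solves v) (c₂-solves v) ⟩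
    P *ₗ e v +ᴹ Q *ₗ e v            ≈⟨ *ₗ-distribʳ (e v) P Q ⟨
    (P + Q) *ₗ e v ∎
    where open ≈ᴹ-Reasoning

  solvable-within-image : ∀ {d P} (ts : List (Term d)) → _*_ IdempotentOn P → Solvable P ts →
                          ∀ e → ∃ λ c → (∀ x → P *ₗ c x ≈ᴹ c x) × (∀ v → ⟦ ts ⟧ c v ≈ᴹ P *ₗ e v)
  solvable-within-image {P = P} ts PP≈P S e with S e
  ... | c , c-solves = (λ x → P *ₗ c x) , (λ x → P-absorbs (c x)) , λ v → begin
    ⟦ ts ⟧ (λ x → P *ₗ c x) v   ≈⟨ ⟦⟧-*ₗ ts P c v ⟩
    P *ₗ ⟦ ts ⟧ c v             ≈⟨ *ₗ-congˡ (c-solves v) ⟩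
    P *ₗ P *ₗ e v               ≈⟨ P-absorbs (e v) ⟩
    P *ₗ e v ∎
    where
    open ≈ᴹ-Reasoning
    P-absorbs : ∀ x → P *ₗ P *ₗ x ≈ᴹ P *ₗ x
    P-absorbs x = ≈ᴹ-trans (≈ᴹ-sym (*ₗ-assoc P P x)) (*ₗ-congʳ PP≈P)

  -- Downward induction on j: a solution for a ^ suc j * P absorbs the term a X^u of a solution for a ^ j * P.
  solvable-insert-nilpotent : ∀ {d P a} (I ts : List (Term d)) u t → _*_ IdempotentOn P → a ^ t * P ≈ 0# →
                              Solvable P (I ++ ts) → Solvable P (I ++ (a , u) ∷ ts)
  solvable-insert-nilpotent {d} {P} {a} I ts u t PP≈P aᵗP≈0 S =
    solvable-resp hs (*-identityˡ P) (descend t (trans (*-congʳ (^-congʳ a (ℕ.+-identityʳ t))) aᵗP≈0))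
    where
    hs : List (Term d)
    hs = I ++ (a , u) ∷ ts
    descend : ∀ k {j} → a ^ (k ℕ.+ j) * P ≈ 0# → Solvable (a ^ j * P) hs
    descend zero    aʲP≈0 = solvable-zero hs aʲP≈0
    descend (suc k) {j} aᵏ⁺ʲ⁺¹P≈0 e with solvable-within-image (I ++ ts) PP≈P S e
    ... | s , Ps≈s , s-solves with descend k {suc j} (trans (*-congʳ (^-congʳ a (ℕ.+-suc k j))) aᵏ⁺ʲ⁺¹P≈0)
                                             (λ x → -ᴹ s (x -ᵖ u))
    ... | c₁ , c₁-solves = (λ x → c₀ x +ᴹ c₁ x) , λ v → begin
      ⟦ hs ⟧ (λ x → c₀ x +ᴹ c₁ x) v
        ≈⟨ ⟦⟧-+ᴹ hs c₀ c₁ v ⟩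
      ⟦ hs ⟧ c₀ v +ᴹ ⟦ hs ⟧ c₁ v
        ≈⟨ +ᴹ-cong (⟦⟧-insert I a u ts c₀ v) (c₁-solves v) ⟩
      (a *ₗ c₀ (v -ᵖ u) +ᴹ ⟦ I ++ ts ⟧ c₀ v) +ᴹ (a ^ suc j * P) *ₗ -ᴹ s (v -ᵖ u)
        ≈⟨ +ᴹ-cong (+ᴹ-congʳ (≈ᴹ-sym (*ₗ-assoc a (a ^ j) _))) (cancel (v -ᵖ u)) ⟩
      (a ^ suc j *ₗ s (v -ᵖ u) +ᴹ ⟦ I ++ ts ⟧ c₀ v) +ᴹ -ᴹ (a ^ suc j *ₗ s (v -ᵖ u))
        ≈⟨ xyx⁻¹≈y _ _ ⟩
      ⟦ I ++ ts ⟧ c₀ v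
        ≈⟨ ⟦⟧-*ₗ (I ++ ts) (a ^ j) s v ⟩
      a ^ j *ₗ ⟦ I ++ ts ⟧ s v
        ≈⟨ *ₗ-congˡ (s-solves v) ⟩
      a ^ j *ₗ P *ₗ e v
        ≈⟨ *ₗ-assoc (a ^ j) P (e v) ⟨
      (a ^ j * P) *ₗ e v ∎
      where
      open ≈ᴹ-Reasoning
      c₀ : Conf d
      c₀ x = a ^ j *ₗ s x
      cancel : ∀ x → (a ^ suc j * P) *ₗ -ᴹ s x ≈ᴹ -ᴹ (a ^ suc j *ₗ s x)
      cancel x = begin
        (a ^ suc j * P) *ₗ -ᴹ s x      ≈⟨ *ₗ-assoc (a ^ suc j) P (-ᴹ s x) ⟩
        a ^ suc j *ₗ P *ₗ -ᴹ s x       ≈⟨ *ₗ-congˡ (-ᴹ‿distribʳ-*ₗ P (s x)) ⟨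
        a ^ suc j *ₗ -ᴹ (P *ₗ s x)     ≈⟨ *ₗ-congˡ (-ᴹ‿cong (Ps≈s x)) ⟩
        a ^ suc j *ₗ -ᴹ s x            ≈⟨ -ᴹ‿distribʳ-*ₗ (a ^ suc j) (s x) ⟨
        -ᴹ (a ^ suc j *ₗ s x) ∎

  infix 4 _∈⟨_⟩
  data _∈⟨_⟩ {d} : Carrier → List (Term d) → Set (r ⊔ ℓr) where
    ∈⟨[]⟩ : ∀ {x} → x ≈ 0# → x ∈⟨ [] ⟩
    ∈⟨∷⟩  : ∀ {x y t ts} w → y ∈⟨ ts ⟩ → x ≈ w * proj₁ t + y → x ∈⟨ t ∷ ts ⟩

  ∈⟨⟩-resp-≈ : ∀ {d x x′} {ts : List (Term d)} → x ≈ x′ → x ∈⟨ ts ⟩ → x′ ∈⟨ ts ⟩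
  ∈⟨⟩-resp-≈ x≈x′ (∈⟨[]⟩ x≈0)        = ∈⟨[]⟩ (trans (sym x≈x′) x≈0)
  ∈⟨⟩-resp-≈ x≈x′ (∈⟨∷⟩ w y∈ x≈wa+y) = ∈⟨∷⟩ w y∈ (trans (sym x≈x′) x≈wa+y)

  ∈⟨⟩-*ʳ : ∀ {d x} {ts : List (Term d)} z → x ∈⟨ ts ⟩ → x * z ∈⟨ ts ⟩
  ∈⟨⟩-*ʳ z (∈⟨[]⟩ x≈0) = ∈⟨[]⟩ (trans (*-congʳ x≈0) (zeroˡ z))
  ∈⟨⟩-*ʳ {x = x} {(a , _) ∷ _} z (∈⟨∷⟩ {y = y} w y∈ x≈wa+y) =
    ∈⟨∷⟩ (w * z) (∈⟨⟩-*ʳ z y∈) (begin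
      x * z               ≈⟨ *-congʳ x≈wa+y ⟩
      (w * a + y) * z     ≈⟨ solve 4 (λ w a y z → (w :* a :+ y) :* z := w :* z :* a :+ y :* z) refl w a y z ⟩
      w * z * a + y * z ∎)
    where open ≈-Reasoning

  ∈⟨⟩-extract : ∀ {d x} (I : List (Term d)) {t ts} → x ∈⟨ I ++ t ∷ ts ⟩ →
                ∃₂ λ w y → y ∈⟨ I ++ ts ⟩ × x ≈ w * proj₁ t + y
  ∈⟨⟩-extract []      (∈⟨∷⟩ w y∈ x≈wa+y) = w , _ , y∈ , x≈wa+y
  ∈⟨⟩-extract {x = x} ((b , _) ∷ I) {a , _} (∈⟨∷⟩ {y = y′} w′ y′∈ x≈w′b+y′) with ∈⟨⟩-extract I y′∈
  ... | w , y , y∈ , y′≈wa+y = w , w′ * b + y , ∈⟨∷⟩ w′ y∈ refl , (begin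
    x                    ≈⟨ x≈w′b+y′ ⟩
    w′ * b + y′          ≈⟨ +-congˡ y′≈wa+y ⟩
    w′ * b + (w * a + y) ≈⟨ +-x∙yz≈y∙xz _ _ _ ⟩
    w * a + (w′ * b + y) ∎)
    where open ≈-Reasoning

  ∈⟨⟩-remove : ∀ {d P Q a u ts} (I : List (Term d)) n →
               P ∈⟨ I ++ (a , u) ∷ ts ⟩ → Q ≈ P * Q → a ^ n * Q ≈ 0# → Q ∈⟨ I ++ ts ⟩
  ∈⟨⟩-remove {P = P} {Q} {a} I n P∈ Q≈PQ aⁿQ≈0 with ∈⟨⟩-extract I P∈
  ... | w , y , y∈ , P≈wa+y =
    let z , Q≈zyQ = absorb-nilpotent n [wa]ⁿQ≈0 Q≈waQ+yQ
    in ∈⟨⟩-resp-≈ (trans (*-comm _ z) (sym Q≈zyQ)) (∈⟨⟩-*ʳ z (∈⟨⟩-*ʳ Q y∈))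
    where
    open ≈-Reasoning
    [wa]ⁿQ≈0 : (w * a) ^ n * Q ≈ 0#
    [wa]ⁿQ≈0 = begin
      (w * a) ^ n * Q        ≈⟨ *-congʳ (^-distrib-* w a n) ⟩
      w ^ n * a ^ n * Q      ≈⟨ *-assoc _ _ _ ⟩
      w ^ n * (a ^ n * Q)    ≈⟨ *-congˡ aⁿQ≈0 ⟩
      w ^ n * 0#             ≈⟨ zeroʳ _ ⟩
      0# ∎
    Q≈waQ+yQ : Q ≈ w * a * Q + y * Q
    Q≈waQ+yQ = trans Q≈PQ (trans (*-congʳ P≈wa+y) (distribʳ Q (w * a) y))

  ∑-∈⟨tabulate⟩ : ∀ {d n} (w a : Fin n → Carrier) (u : Fin n → Point d) →
                  ∑[ i < n ] (w i * a i) ∈⟨ tabulate (λ i → a i , u i) ⟩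
  ∑-∈⟨tabulate⟩ {n = zero}  w a u = ∈⟨[]⟩ refl
  ∑-∈⟨tabulate⟩ {n = suc n} w a u =
    ∈⟨∷⟩ (w Fin.zero) (∑-∈⟨tabulate⟩ (w ∘ Fin.suc) (a ∘ Fin.suc) (u ∘ Fin.suc)) refl

  height : ∀ {d} → Term (suc d) → ℤ
  height = Vec.head ∘ proj₂

  layer : ∀ {d} → Conf (suc d) → ℤ → Conf d
  layer c z w = c (z ∷ w)

  Vanishes : ∀ {d} → (ℤ → Set) → Conf (suc d) → Set ℓm
  Vanishes Q e = ∀ z w → Q z → e (z ∷ w) ≈ᴹ 0ᴹ

  slice : ∀ {d} → ℤ → List (Term (suc d)) → List (Term d)
  slice a []                 = []
  slice a ((α , h ∷ w) ∷ ts) with h ℤ.≟ a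
  ... | yes _ = (α , w) ∷ slice a ts
  ... | no  _ = slice a ts

  off-slice : ∀ {d} → ℤ → List (Term (suc d)) → List (Term (suc d))
  off-slice a []                 = []
  off-slice a ((α , h ∷ w) ∷ ts) with h ℤ.≟ a
  ... | yes _ = off-slice a ts
  ... | no  _ = (α , h ∷ w) ∷ off-slice a ts

  ⟦⟧-slice : ∀ {d} a (ts : List (Term (suc d))) c z v →
             ⟦ ts ⟧ c (z ∷ v) ≈ᴹ ⟦ slice a ts ⟧ (layer c (z ℤ.- a)) v +ᴹ ⟦ off-slice a ts ⟧ c (z ∷ v)
  ⟦⟧-slice a []                 c z v = ≈ᴹ-sym (+ᴹ-identityˡ 0ᴹ)
  ⟦⟧-slice a ((α , h ∷ w) ∷ ts) c z v with h ℤ.≟ a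
  ... | yes ≡.refl = ≈ᴹ-trans (+ᴹ-congˡ (⟦⟧-slice a ts c z v)) (≈ᴹ-sym (+ᴹ-assoc _ _ _))
  ... | no  _      = ≈ᴹ-trans (+ᴹ-congˡ (⟦⟧-slice a ts c z v)) (x∙yz≈y∙xz _ _ _)

  slice-All : ∀ {d p} {Q : Carrier → Set p} a (ts : List (Term (suc d))) →
              All (Q ∘ proj₁) ts → All (Q ∘ proj₁) (slice a ts)
  slice-All a []                 []        = []
  slice-All a ((α , h ∷ w) ∷ ts) (qα ∷ qs) with h ℤ.≟ a
  ... | yes _ = qα ∷ slice-All a ts qs
  ... | no  _ = slice-All a ts qs

  off-slice-above : ∀ {d} a (ts : List (Term (suc d))) →
                    All (λ t → a ℤ.≤ height t) ts → All (λ t → a ℤ.< height t) (off-slice a ts)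
  off-slice-above a []                 []          = []
  off-slice-above a ((α , h ∷ w) ∷ ts) (a≤h ∷ a≤s) with h ℤ.≟ a
  ... | yes _   = off-slice-above a ts a≤s
  ... | no  h≢a = ℤ.≤∧≢⇒< a≤h (h≢a ∘ ≡.sym) ∷ off-slice-above a ts a≤s

  slice-distinct : ∀ {d} a (ts : List (Term (suc d))) → Distinct ts → Distinct (slice a ts)
  slice-distinct a []                 []            = []
  slice-distinct a ((α , h ∷ w) ∷ ts) (t∉ts ∷ dist) with h ℤ.≟ a
  ... | yes ≡.refl = tails-distinct ts t∉ts ∷ slice-distinct a ts dist
    where
    tails-distinct : ∀ ts → All (λ t → h ∷ w ≢ proj₂ t) ts → All (λ t → w ≢ proj₂ t) (slice h ts)
    tails-distinct []                   []         = []
    tails-distinct ((β , h′ ∷ w′) ∷ ts) (≢t ∷ ≢ts) with h′ ℤ.≟ h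
    ... | yes ≡.refl = (≢t ∘ ≡.cong (h ∷_)) ∷ tails-distinct ts ≢ts
    ... | no  _      = tails-distinct ts ≢ts
  ... | no  _      = slice-distinct a ts dist

  ∈-slice : ∀ {d} {t : Term (suc d)} {ts} → t ∈ ts → map₂ Vec.tail t ∈ slice (height t) ts
  ∈-slice {t = α , a ∷ w} (here ≡.refl) with a ℤ.≟ a
  ... | yes _   = here ≡.refl
  ... | no  a≢a = ⊥-elim (a≢a ≡.refl)
  ∈-slice {t = α , a ∷ w} {(β , h ∷ w′) ∷ ts} (there t∈ts) with h ℤ.≟ a
  ... | yes _ = there (∈-slice t∈ts)
  ... | no  _ = ∈-slice t∈ts

  lowest : ∀ {d t} (ts : List (Term (suc d))) → t ∈ ts →
           ∃ λ t₀ → t₀ ∈ ts × All (λ t → height t₀ ℤ.≤ height t) ts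
  lowest {t = t} ts t∈ts = argmin height t ts , argmin-all height t∈ts (All.tabulate id) , f[argmin]≤f[xs] t ts

  P[x-y]+y≈Px : ∀ {P} x y → P *ₗ y ≈ᴹ y → P *ₗ (x +ᴹ -ᴹ y) +ᴹ y ≈ᴹ P *ₗ x
  P[x-y]+y≈Px {P} x y Py≈y = begin
    P *ₗ (x +ᴹ -ᴹ y) +ᴹ y
      ≈⟨ +ᴹ-congʳ (*ₗ-distribˡ P x (-ᴹ y)) ⟩
    (P *ₗ x +ᴹ P *ₗ -ᴹ y) +ᴹ y
      ≈⟨ +ᴹ-congʳ (+ᴹ-congˡ (≈ᴹ-trans (≈ᴹ-sym (-ᴹ‿distribʳ-*ₗ P y)) (-ᴹ‿cong Py≈y))) ⟩
    (P *ₗ x +ᴹ -ᴹ y) +ᴹ y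
      ≈⟨ //-rightDividesˡ y (P *ₗ x) ⟩
    P *ₗ x ∎
    where open ≈ᴹ-Reasoning

  -- The layers of the solution are built upwards: the equation at height z + a fixes, through the slice at a,
  -- the layer at z, once all lower layers are known.
  module Upwards {d : ℕ} {P : Carrier} (a : ℤ) (ts : List (Term (suc d))) (PP≈P : _*_ IdempotentOn P)
                 (a≤ts : All (λ t → a ℤ.≤ height t) ts) (S : Solvable P (slice a ts))
                 (e : Conf (suc d)) (e≈0 : Vanishes (ℤ._< a) e) where

    glue : (ℤ → Conf d) → Conf (suc d)
    glue L (z ∷ w) = L z w

    target : ℕ → (ℤ → Conf d) → Conf d
    target k L w = e (+ k ℤ.+ a ∷ w) +ᴹ -ᴹ ⟦ off-slice a ts ⟧ (glue L) (+ k ℤ.+ a ∷ w)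

    layer-solution : ∀ k L →
                     ∃ λ s → (∀ x → P *ₗ s x ≈ᴹ s x) × (∀ w → ⟦ slice a ts ⟧ s w ≈ᴹ P *ₗ target k L w)
    layer-solution k L = solvable-within-image (slice a ts) PP≈P S (target k L)

    open CourseOfValues (λ _ → 0ᴹ) (λ k L → proj₁ (layer-solution k L))

    c : Conf (suc d)
    c = glue fix

    c-fixed : ∀ x → P *ₗ c x ≈ᴹ c x
    c-fixed (+ k ∷ w)      = proj₁ (proj₂ (layer-solution k (history k))) w
    c-fixed (-[1+ _ ] ∷ w) = *ₗ-zeroʳ P

    equation-below : ∀ {z} j w → z ℤ.- a ≡ -[1+ j ] → ⟦ ts ⟧ c (z ∷ w) ≈ᴹ P *ₗ e (z ∷ w)
    equation-below {z} j w z-a≡ = begin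
      ⟦ ts ⟧ c (z ∷ w)             ≈⟨ ⟦⟧-cong ts (z ∷ w) (All.map (λ {t} → vanishes t) a≤ts) ⟩
      ⟦ ts ⟧ (λ _ → 0ᴹ) (z ∷ w)    ≈⟨ ⟦⟧-zero ts (z ∷ w) ⟩
      0ᴹ                           ≈⟨ *ₗ-zeroʳ P ⟨
      P *ₗ 0ᴹ                      ≈⟨ *ₗ-congˡ (e≈0 z w z<a) ⟨
      P *ₗ e (z ∷ w) ∎
      where
      open ≈ᴹ-Reasoning
      z-a<0 : z ℤ.- a ℤ.< + 0
      z-a<0 = ≡.subst (ℤ._< + 0) (≡.sym z-a≡) ℤ.-<+
      z<a : z ℤ.< a
      z<a = ≡.subst₂ ℤ._<_ (ℤ-Group.//-rightDividesˡ a z) (ℤ.+-identityˡ a) (ℤ.+-monoˡ-< a z-a<0)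
      vanishes : ∀ t → a ℤ.≤ height t → c ((z ∷ w) -ᵖ proj₂ t) ≈ᴹ 0ᴹ
      vanishes (α , h ∷ u) a≤h = ≈ᴹ-reflexive (≡.cong (λ L → L (w -ᵖ u))
        (fix-negative (ℤ.≤-<-trans (ℤ.+-monoʳ-≤ z (ℤ.neg-mono-≤ a≤h)) z-a<0)))

    equation-above : ∀ {z} k w → z ℤ.- a ≡ + k → ⟦ ts ⟧ c (z ∷ w) ≈ᴹ P *ₗ e (z ∷ w)
    equation-above {z} k w z-a≡ = begin
      ⟦ ts ⟧ c (z ∷ w)
        ≈⟨ ⟦⟧-slice a ts c z w ⟩
      ⟦ slice a ts ⟧ (layer c (z ℤ.- a)) w +ᴹ A
        ≡⟨ ≡.cong (λ y → ⟦ slice a ts ⟧ (layer c y) w +ᴹ A) z-a≡ ⟩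
      ⟦ slice a ts ⟧ (layer c (+ k)) w +ᴹ A
        ≈⟨ +ᴹ-congʳ (proj₂ (proj₂ (layer-solution k (history k))) w) ⟩
      P *ₗ target k (history k) w +ᴹ A
        ≡⟨ ≡.cong (λ y → P *ₗ (e (y ∷ w) +ᴹ -ᴹ Aₖ y) +ᴹ A) (≡.sym z≡k+a) ⟩
      P *ₗ (e (z ∷ w) +ᴹ -ᴹ Aₖ z) +ᴹ A
        ≈⟨ +ᴹ-congʳ (*ₗ-congˡ (+ᴹ-congˡ (-ᴹ‿cong history-agrees-below))) ⟩
      P *ₗ (e (z ∷ w) +ᴹ -ᴹ A) +ᴹ A
        ≈⟨ P[x-y]+y≈Px (e (z ∷ w)) A A-fixed ⟩
      P *ₗ e (z ∷ w) ∎
      where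
      open ≈ᴹ-Reasoning
      A : Carrierᴹ
      A = ⟦ off-slice a ts ⟧ c (z ∷ w)
      Aₖ : ℤ → Carrierᴹ
      Aₖ y = ⟦ off-slice a ts ⟧ (glue (history k)) (y ∷ w)
      z≡k+a : z ≡ + k ℤ.+ a
      z≡k+a = ≡.trans (≡.sym (ℤ-Group.//-rightDividesˡ a z)) (≡.cong (ℤ._+ a) z-a≡)
      agrees : ∀ t → a ℤ.< height t → glue (history k) ((z ∷ w) -ᵖ proj₂ t) ≈ᴹ c ((z ∷ w) -ᵖ proj₂ t)
      agrees (α , h ∷ u) a<h = ≈ᴹ-reflexive (≡.cong (λ L → L (w -ᵖ u))
        (history-agrees k (≡.subst (z ℤ.- h ℤ.<_) z-a≡ (ℤ.+-monoʳ-< z (ℤ.neg-mono-< a<h)))))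
      history-agrees-below : Aₖ z ≈ᴹ A
      history-agrees-below =
        ⟦⟧-cong (off-slice a ts) (z ∷ w) (All.map (λ {t} → agrees t) (off-slice-above a ts a≤ts))
      A-fixed : P *ₗ A ≈ᴹ A
      A-fixed = ≈ᴹ-trans (≈ᴹ-sym (⟦⟧-*ₗ (off-slice a ts) P c (z ∷ w)))
                         (⟦⟧-congʳ (off-slice a ts) c-fixed (z ∷ w))

    equation : ∀ v → ⟦ ts ⟧ c v ≈ᴹ P *ₗ e v
    equation (z ∷ w) with z ℤ.- a in z-a≡
    ... | -[1+ j ] = equation-below j w z-a≡
    ... | + k      = equation-above k w z-a≡

  solvable-above : ∀ {d P} a (ts : List (Term (suc d))) → _*_ IdempotentOn P →
                   All (λ t → a ℤ.≤ height t) ts → Solvable P (slice a ts) →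
                   ∀ e → Vanishes (ℤ._< a) e → Solution P ts e
  solvable-above a ts PP≈P a≤ts S e e≈0 = c , equation
    where open Upwards a ts PP≈P a≤ts S e e≈0

  reflect : ∀ {d} → Point (suc d) → Point (suc d)
  reflect (z ∷ w) = ℤ.- z ∷ w

  reflect-involutive : ∀ {d} (v : Point (suc d)) → reflect (reflect v) ≡ v
  reflect-involutive (z ∷ w) = ≡.cong (_∷ w) (ℤ.neg-involutive z)

  mirror : ∀ {d} → List (Term (suc d)) → List (Term (suc d))
  mirror = map (map₂ reflect)

  height-mirror : ∀ {d} (t : Term (suc d)) → height (map₂ reflect t) ≡ ℤ.- height t
  height-mirror (α , z ∷ w) = ≡.refl

  ⟦⟧-mirror : ∀ {d} (ts : List (Term (suc d))) c v → ⟦ mirror ts ⟧ c (reflect v) ≈ᴹ ⟦ ts ⟧ (c ∘ reflect) v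
  ⟦⟧-mirror []                 c v       = ≈ᴹ-refl
  ⟦⟧-mirror ((α , h ∷ u) ∷ ts) c (z ∷ w) =
    +ᴹ-cong (≈ᴹ-reflexive (≡.cong (λ y → α *ₗ c (y ∷ (w -ᵖ u))) (≡.sym (ℤ.neg-distrib-+ z (ℤ.- h)))))
            (⟦⟧-mirror ts c (z ∷ w))

  mirror-distinct : ∀ {d} {ts : List (Term (suc d))} → Distinct ts → Distinct (mirror ts)
  mirror-distinct = AllPairs.map⁺ ∘ AllPairs.map (λ u≢u′ → u≢u′ ∘ reflect-injective)
    where
    reflect-injective : ∀ {u u′} → reflect u ≡ reflect u′ → u ≡ u′
    reflect-injective {u} {u′} eq =
      ≡.trans (≡.sym (reflect-involutive u)) (≡.trans (≡.cong reflect eq) (reflect-involutive u′))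

  solvable-below : ∀ {d P} b (ts : List (Term (suc d))) → _*_ IdempotentOn P →
                   All (λ t → b ℤ.≤ height t) (mirror ts) → Solvable P (slice b (mirror ts)) →
                   ∀ e → Vanishes (ℤ.- b ℤ.<_) e → Solution P ts e
  solvable-below {P = P} b ts PP≈P b≤ts S e e≈0
    with solvable-above b (mirror ts) PP≈P b≤ts S (e ∘ reflect) (λ z w z<b → e≈0 (ℤ.- z) w (ℤ.neg-mono-< z<b))
  ... | c , c-solves = c ∘ reflect , λ v → begin
    ⟦ ts ⟧ (c ∘ reflect) v          ≈⟨ ⟦⟧-mirror ts c v ⟨
    ⟦ mirror ts ⟧ c (reflect v)     ≈⟨ c-solves (reflect v) ⟩
    P *ₗ e (reflect (reflect v))    ≡⟨ ≡.cong (λ x → P *ₗ e x) (reflect-involutive v) ⟩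
    P *ₗ e v ∎
    where open ≈ᴹ-Reasoning

  lower upper : ∀ {d} → ℤ → Conf (suc d) → Conf (suc d)
  lower a e (z ∷ w) with z ℤ.<? a
  ... | yes _ = e (z ∷ w)
  ... | no  _ = 0ᴹ
  upper a e (z ∷ w) with z ℤ.<? a
  ... | yes _ = 0ᴹ
  ... | no  _ = e (z ∷ w)

  upper+lower : ∀ {d} a (e : Conf (suc d)) v → upper a e v +ᴹ lower a e v ≈ᴹ e v
  upper+lower a e (z ∷ w) with z ℤ.<? a
  ... | yes _ = +ᴹ-identityˡ (e (z ∷ w))
  ... | no  _ = +ᴹ-identityʳ (e (z ∷ w))

  upper-vanishes : ∀ {d} a (e : Conf (suc d)) → Vanishes (ℤ._< a) (upper a e)
  upper-vanishes a e z w z<a with z ℤ.<? a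
  ... | yes _   = ≈ᴹ-refl
  ... | no  z≮a = ⊥-elim (z≮a z<a)

  lower-vanishes : ∀ {d} a (e : Conf (suc d)) → Vanishes (a ℤ.≤_) (lower a e)
  lower-vanishes a e z w a≤z with z ℤ.<? a
  ... | yes z<a = ⊥-elim (ℤ.<-irrefl ≡.refl (ℤ.<-≤-trans z<a a≤z))
  ... | no  _   = ≈ᴹ-refl

  solvable-by-halves : ∀ {d P} a (ts : List (Term (suc d))) →
                       (∀ e → Vanishes (ℤ._< a) e → Solution P ts e) →
                       (∀ e → Vanishes (a ℤ.≤_) e → Solution P ts e) → Solvable P ts
  solvable-by-halves {P = P} a ts upper-solvable lower-solvable e
    with upper-solvable (upper a e) (upper-vanishes a e) | lower-solvable (lower a e) (lower-vanishes a e)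
  ... | c₊ , c₊-solves | c₋ , c₋-solves = (λ x → c₊ x +ᴹ c₋ x) , λ v → begin
    ⟦ ts ⟧ (λ x → c₊ x +ᴹ c₋ x) v           ≈⟨ ⟦⟧-+ᴹ ts c₊ c₋ v ⟩
    ⟦ ts ⟧ c₊ v +ᴹ ⟦ ts ⟧ c₋ v              ≈⟨ +ᴹ-cong (c₊-solves v) (c₋-solves v) ⟩
    P *ₗ upper a e v +ᴹ P *ₗ lower a e v    ≈⟨ *ₗ-distribˡ P _ _ ⟨
    P *ₗ (upper a e v +ᴹ lower a e v)       ≈⟨ *ₗ-congˡ (upper+lower a e v) ⟩
    P *ₗ e v ∎
    where open ≈ᴹ-Reasoning

  solvable-single : ∀ {P α} → InvertibleOn P α → Solvable P ((α , []) ∷ [])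
  solvable-single {P} {α} (β , αβP≈P) e = (λ x → (β * P) *ₗ e x) , equation
    where
    equation : ∀ v → ⟦ (α , []) ∷ [] ⟧ (λ x → (β * P) *ₗ e x) v ≈ᴹ P *ₗ e v
    equation [] = begin
      α *ₗ (β * P) *ₗ e [] +ᴹ 0ᴹ   ≈⟨ +ᴹ-identityʳ _ ⟩
      α *ₗ (β * P) *ₗ e []         ≈⟨ *ₗ-assoc α (β * P) (e []) ⟨
      (α * (β * P)) *ₗ e []        ≈⟨ *ₗ-congʳ (trans (sym (*-assoc α β P)) αβP≈P) ⟩
      P *ₗ e [] ∎
      where open ≈ᴹ-Reasoning

  solvable-invertible : ∀ {d P} (ts : List (Term d)) {t} → t ∈ ts → _*_ IdempotentOn P →
                        All (InvertibleOn P ∘ proj₁) ts → Distinct ts → Solvable P ts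
  solvable-invertible {zero} ((α , []) ∷ []) _ _ (inv ∷ []) _ = solvable-single inv
  solvable-invertible {zero} ((α , []) ∷ (β , []) ∷ ts) _ _ _ (([]≢[] ∷ _) ∷ _) = ⊥-elim ([]≢[] ≡.refl)
  solvable-invertible {suc d} {P} ts t∈ts PP≈P inv dist
    with lowest ts t∈ts | lowest (mirror ts) (∈-map⁺ (map₂ reflect) t∈ts)
  ... | t₀ , t₀∈ts , t₀-lowest | t₁ , t₁∈mirror , t₁-lowest =
    solvable-by-halves (height t₀) ts
      (solvable-above (height t₀) ts PP≈P t₀-lowest
        (solvable-invertible (slice (height t₀) ts) (∈-slice t₀∈ts) PP≈P
          (slice-All (height t₀) ts inv) (slice-distinct (height t₀) ts dist)))
      λ e e≈0 → solvable-below (height t₁) ts PP≈P t₁-lowest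
        (solvable-invertible (slice (height t₁) (mirror ts)) (∈-slice t₁∈mirror) PP≈P
          (slice-All (height t₁) (mirror ts) (All.map⁺ inv))
          (slice-distinct (height t₁) (mirror ts) (mirror-distinct dist)))
        e (λ z w -b<z → e≈0 z w (ℤ.<⇒≤ (ℤ.≤-<-trans a≤-b -b<z)))
    where
    a≤-b : height t₀ ℤ.≤ ℤ.- height t₁
    a≤-b = ≡.subst (ℤ._≤ ℤ.- height t₁) (ℤ.neg-involutive (height t₀))
      (ℤ.neg-mono-≤ (≡.subst (height t₁ ℤ.≤_) (height-mirror t₀)
        (All.lookup t₁-lowest (∈-map⁺ (map₂ reflect) t₀∈ts))))

  distinct-remove : ∀ {d} (I : List (Term d)) {t ts} → Distinct (I ++ t ∷ ts) → Distinct (I ++ ts)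
  distinct-remove []      (_ ∷ dist)   = dist
  distinct-remove (s ∷ I) (s∉ ∷ dist) = All-remove s∉ ∷ distinct-remove I dist
    where
    All-remove : ∀ {p} {Q : Term _ → Set p} {t ts} → All Q (I ++ t ∷ ts) → All Q (I ++ ts)
    All-remove qs = All.++⁺ (All.++⁻ˡ I qs) (All.tail (All.++⁻ʳ I qs))

  solvable : IdempotentPowers → ∀ {d P} (I ts : List (Term d)) → _*_ IdempotentOn P → P ∈⟨ I ++ ts ⟩ →
             All (InvertibleOn P ∘ proj₁) I → Distinct (I ++ ts) → Solvable P (I ++ ts)
  solvable powers []      [] _ (∈⟨[]⟩ P≈0) _ _ = solvable-zero [] P≈0
  solvable powers {P = P} (t ∷ I) [] PP≈P _ inv dist =
    ≡.subst (Solvable P) (≡.sym I++[]≡I)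
      (solvable-invertible (t ∷ I) (here ≡.refl) PP≈P inv (≡.subst Distinct I++[]≡I dist))
    where
    I++[]≡I : (t ∷ I) ++ [] ≡ t ∷ I
    I++[]≡I = List.++-identityʳ (t ∷ I)
  solvable powers {P = P} I ((a , u) ∷ ts) PP≈P P∈ inv dist with powers a
  ... | n , EE≈E =
    solvable-resp hs (sym (x≈xe+x[1-e] P E)) (solvable-+ hs invertible-part nilpotent-part)
    where
    hs : List (Term _)
    hs = I ++ (a , u) ∷ ts
    E : Carrier
    E = a ^ suc n
    reassoc : (I ++ [ a , u ]) ++ ts ≡ hs
    reassoc = List.++-assoc I [ a , u ] ts
    invertible-part : Solvable (P * E) hs
    invertible-part = ≡.subst (Solvable (P * E)) reassoc
      (solvable powers (I ++ [ a , u ]) ts (idempotentOn-* PP≈P EE≈E)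
        (≡.subst (P * E ∈⟨_⟩) (≡.sym reassoc) (∈⟨⟩-*ʳ E P∈))
        (All.++⁺ (All.map (invertibleOn-* E) inv) (power-invertibleOn n P EE≈E ∷ []))
        (≡.subst Distinct (≡.sym reassoc) dist))
    QQ≈Q : _*_ IdempotentOn (P * (1# - E))
    QQ≈Q = idempotentOn-* PP≈P (complement-idempotent EE≈E)
    Q≈PQ : P * (1# - E) ≈ P * (P * (1# - E))
    Q≈PQ = sym (trans (sym (*-assoc P P _)) (*-congʳ PP≈P))
    nilpotent-part : Solvable (P * (1# - E)) hs
    nilpotent-part = solvable-insert-nilpotent I ts u (suc n) QQ≈Q (e*[f*[1-e]]≈0 P EE≈E)
      (solvable powers I ts QQ≈Q (∈⟨⟩-remove I (suc n) P∈ Q≈PQ (e*[f*[1-e]]≈0 P EE≈E))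
        (All.map (invertibleOn-* (1# - E)) inv) (distinct-remove I dist))

  surjective : IdempotentPowers → ∀ {d} (ts : List (Term d)) → Distinct ts → 1# ∈⟨ ts ⟩ →
               ∀ e → ∃ λ c → ∀ v → ⟦ ts ⟧ c v ≈ᴹ e v
  surjective powers ts dist 1∈ e with solvable powers [] ts (*-identityˡ 1#) 1∈ [] dist e
  ... | c , c-solves = c , λ v → ≈ᴹ-trans (c-solves v) (*ₗ-identityˡ (e v))

-- Commuting matrix coefficients

module CoefficientAlgebra {p n k : ℕ} .{{_ : NonZero p}} (A C : Fin (suc k) → Mat p n)
  (AA : ∀ i j → Commute (A i) (A j)) (CC : ∀ i j → Commute (C i) (C j)) (CA : ∀ i j → Commute (C i) (A j))
  where

  generators : Fin (suc k) ⊎ Fin (suc k) → Mat p n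
  generators (inj₁ i) = A i
  generators (inj₂ i) = C i

  generators-commute : ∀ i j → Commute (generators i) (generators j)
  generators-commute (inj₁ i) (inj₁ j) = AA i j
  generators-commute (inj₁ i) (inj₂ j) r s = ≡.sym (CA j i r s)
  generators-commute (inj₂ i) (inj₁ j) = CA i j
  generators-commute (inj₂ i) (inj₂ j) = CC i j

  open Bicommutant Mat-ring generators generators-commute
  open CommutativeRing commutativeRing using (1#; _*_; semiring; *-assoc; *-congˡ)
  open Idempotents commutativeRing using (IdempotentPowers; idempotent-power)
  open import Algebra.Properties.Semiring.Exp semiring using (_^_)

  idempotentPowers : IdempotentPowers
  idempotentPowers x with Mat-pigeonhole (λ j → proj₁ (x ^ j))
  ... | a , b , a<b , xᵃ≈xᵇ = idempotent-power x xᵃ≈xᵇ a<b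

  open import Algebra.Properties.Semiring.Sum semiring using (sum; sum-syntax; sum-cong-≋; *-distribˡ-sum)
  open CellularAutomaton commutativeRing (leftModule ZVec-leftModule)

  Â Ĉ : Fin (suc k) → Element
  Â = embed ∘ inj₁
  Ĉ = embed ∘ inj₂

  scalar : Zp p → Element
  scalar x = central (scalarI x) (scalarI-central x)

  proj₁-∑ : ∀ {m} (f : Fin m → Element) → proj₁ (sum f) ≡ ΣM m (proj₁ ∘ f)
  proj₁-∑ {zero}  f = ≡.refl
  proj₁-∑ {suc m} f = ≡.cong (proj₁ (f Fin.zero) ⊕_) (proj₁-∑ (f ∘ Fin.suc))

  one-∈⟨⟩ : ∀ {d M} M⁻¹ (u : Fin (suc k) → Point d) → M⁻¹ *ₚ M ≡ 1ₚ →
            ΣM (suc k) (λ i → C i ⊗ A i) ≈M scalarI M → 1# ∈⟨ tabulate (λ i → Â i , u i) ⟩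
  one-∈⟨⟩ {M = M} M⁻¹ u M⁻¹M≡1 ΣCA≈M = ∈⟨⟩-resp-≈ (begin
    ∑[ i < suc k ] (scalar M⁻¹ * Ĉ i * Â i)
      ≈⟨ sum-cong-≋ {x = λ i → scalar M⁻¹ * Ĉ i * Â i} {y = λ i → scalar M⁻¹ * (Ĉ i * Â i)}
                    (λ i → *-assoc (scalar M⁻¹) (Ĉ i) (Â i)) ⟩
    ∑[ i < suc k ] (scalar M⁻¹ * (Ĉ i * Â i))
      ≈⟨ *-distribˡ-sum (scalar M⁻¹) (λ i → Ĉ i * Â i) ⟨
    scalar M⁻¹ * ∑[ i < suc k ] (Ĉ i * Â i)
      ≈⟨ *-congˡ {scalar M⁻¹} {∑[ i < suc k ] (Ĉ i * Â i)} {scalar M} ΣCA≈M′ ⟩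
    scalar M⁻¹ * scalar M
      ≈⟨ (λ r s → ≡.trans (scalarI-⊗ M⁻¹ M r s) (≡.cong (λ x → scalarI x r s) M⁻¹M≡1)) ⟩
    1# ∎)
    (∑-∈⟨tabulate⟩ (λ i → scalar M⁻¹ * Ĉ i) Â u)
    where
    open SetoidReasoning (CommutativeRing.setoid commutativeRing)
    ΣCA≈M′ : proj₁ (∑[ i < suc k ] (Ĉ i * Â i)) ≈M scalarI M
    ΣCA≈M′ r s = ≡.trans (≡.cong (λ X → X r s) (proj₁-∑ (λ i → Ĉ i * Â i))) (ΣCA≈M r s)

  ⟦tabulate⟧≡ΣV : ∀ {d m} (x : Fin m → Element) (u : Fin m → Point d) c v →
                  ⟦ tabulate (λ i → x i , u i) ⟧ c v ≡ ΣV m (λ i → proj₁ (x i) · c (v -ᵖ u i))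
  ⟦tabulate⟧≡ΣV {m = zero}  x u c v = ≡.refl
  ⟦tabulate⟧≡ΣV {m = suc m} x u c v =
    ≡.cong ((proj₁ (x Fin.zero) · c (v -ᵖ u Fin.zero)) ⊞_)
           (⟦tabulate⟧≡ΣV (x ∘ Fin.suc) (u ∘ Fin.suc) c v)

  additiveCA-surjective : ∀ {d} (u : Fin (suc k) → Point d) → Injective _≡_ _≡_ u →
                          1# ∈⟨ tabulate (λ i → Â i , u i) ⟩ → Surjective (additiveCA k A u)
  additiveCA-surjective u u-injective 1∈ e = proj₁ solution , λ v j →
    ≡.trans (≡.cong (λ w → w j) (≡.sym (⟦tabulate⟧≡ΣV Â u (proj₁ solution) v))) (proj₂ solution v j)
    where
    solution : ∃ λ c → ∀ v → ⟦ tabulate (λ i → Â i , u i) ⟧ c v ≗ e v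
    solution = surjective idempotentPowers (tabulate (λ i → Â i , u i))
      (AllPairs.tabulate⁺ {f = λ i → Â i , u i} (λ i≢j → i≢j ∘ u-injective)) 1∈ e

lemma16 : (p : ℕ) .{{_ : NonZero p}} → Prime p → (d n : ℕ) → d ≥ 1 → n ≥ 1
    → (k : ℕ) (A : Fin (suc k) → Mat p n) (u : Fin (suc k) → Point d)
    → Injective _≡_ _≡_ u
    → (∀ i j → Commute (A i) (A j))
    → (M : Zp p) → toℕ M ≢ 0
    → (C : Fin (suc k) → Mat p n)
    → (∀ i j → Commute (C i) (C j))
    → (∀ i j → Commute (C i) (A j))
    → ΣM (suc k) (λ i → C i ⊗ A i) ≈M scalarI M
    → Surjective (additiveCA k A u)
lemma16 p p-prime d n _ _ k A u u-injective AA M M≢0 C CC CA ΣCA≈M with Zp-inverse p-prime M M≢0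
... | M⁻¹ , M⁻¹M≡1 = additiveCA-surjective u u-injective (one-∈⟨⟩ M⁻¹ u M⁻¹M≡1 ΣCA≈M)
  where open CoefficientAlgebra A C AA CC CA
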